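{- Let $n,r$ be positive integers and let $\mathcal{P}(n-1,r,r+1)$ be the set of lattice paths with steps $(1,1)$ (up) and $(1,-r)$ (down) from $(0,0)$ to $((r+1)n,r+1)$ (so with $rn+1$ up steps and $n-1$ down steps, in positions $0,1,\dots,(r+1)n-1$). Then: (1) for integers $n_0\ge2$ and $n_1,\dots,n_r\ge1$ with $\sum_{i=0}^r(n_i-1)=n-1$, and for each $j=1,\dots,n_0-1$, the number of paths in $\mathcal{P}(n-1,r,r+1)$ that start with a down step, have exactly $n_i-1$ down steps in positions congruent to $i \pmod{r+1}$ for each $i=0,\dots,r$, and have exactly $j$ down steps in positions congruent to $0\pmod{r+1}$ starting on or below the $x$-axis, is independent of $j$ and equals $\frac{1}{n_0-1}\binom{n-1}{n_0-2}\binom{n}{n_1-1}\cdots\binom{n}{n_r-1}$; (2) for integers $n_0\ge1$ and $n_1,\dots,n_r\ge0$ with $\sum_{i=0}^r n_i=rn+1$, and for each $j=1,\dots,n_0$, the number of paths in $\mathcal{P}(n-1,r,r+1)$ that start with an up step, have exactly $n_i$ up steps in positions congruent to $i\pmod{r+1}$ for each $i=0,\dots,r$, and have exactly $j$ up steps in positions congruent to $0\pmod{r+1}$ starting on or below the $x$-axis, is independent of $j$ and equals $\frac{1}{n_0}\binom{n-1}{n_0-1}\binom{n}{n_1}\cdots\binom{n}{n_r}$.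
   Context: The position of a step is the $x$-coordinate of its initial vertex. A step starts on or below the $x$-axis if its initial vertex has $y$-coordinate $\le0$. -}

module Defs where

open import Data.Bool using (Bool; true; false; _∧_; not; if_then_else_)
open import Data.Nat using (ℕ; zero; suc; _+_; _*_; _∸_; _%_)
import Data.Nat as ℕ
open import Data.Integer using (ℤ; +_; _-_; -_)
import Data.Integer as ℤ
open import Data.Fin using (Fin; toℕ)
open import Data.List using (List; []; _∷_; map; _++_; length; filterᵇ; allFin)
open import Data.Bool.ListAction using (and)
open import Data.Product using (_×_; _,_)
open import Relation.Nullary.Decidable using (⌊_⌋)

-- A lattice path is a list of steps: true = up step (1,1), false = down step (1,-r).
Path : Set
Path = List Bool

allPaths : ℕ → List Path
allPaths zero = [] ∷ []
allPaths (suc L) = map (true ∷_) (allPaths L) ++ map (false ∷_) (allPaths L)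

numDown : Path → ℕ
numDown p = length (filterᵇ not p)

-- P(n-1, r, r+1): paths of length (r+1)n from (0,0) to ((r+1)n, r+1), i.e. with
-- n-1 down steps (hence rn+1 up steps).
𝒫 : ℕ → ℕ → List Path
𝒫 n r = filterᵇ (λ p → ⌊ numDown p ℕ.≟ n ∸ 1 ⌋) (allPaths (suc r * n))

-- Each step annotated with (position = x-coordinate of initial vertex,
-- y-coordinate of initial vertex, the step itself); up = +1, down = -r.
annotate : ℕ → ℕ → ℤ → Path → List (ℕ × ℤ × Bool)
annotate r x y [] = []
annotate r x y (s ∷ p) =
  (x , y , s) ∷ annotate r (suc x) (if s then y ℤ.+ ℤ.+ 1 else y ℤ.- ℤ.+ r) p

steps : ℕ → Path → List (ℕ × ℤ × Bool)
steps r p = annotate r 0 (ℤ.+ 0) p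

numAt : ℕ → Bool → ℕ → Path → ℕ
numAt r b i p = length (filterᵇ
  (λ { (x , y , s) → ⌊ Data.Bool._≟_ s b ⌋ ∧ ⌊ x % suc r ℕ.≟ i ⌋ }) (steps r p))

numLow : ℕ → Bool → Path → ℕ
numLow r b p = length (filterᵇ
  (λ { (x , y , s) → ⌊ Data.Bool._≟_ s b ⌋ ∧ ⌊ x % suc r ℕ.≟ 0 ⌋ ∧ ⌊ y ℤ.≤? ℤ.+ 0 ⌋ })
  (steps r p))

startsWith : Bool → Path → Bool
startsWith b [] = false
startsWith b (s ∷ _) = ⌊ Data.Bool._≟_ s b ⌋

count : (n r : ℕ) → Bool → (Fin (suc r) → ℕ) → ℕ → ℕ
count n r b m j = length (filterᵇ
  (λ p → startsWith b p
       ∧ and (map (λ i → ⌊ numAt r b (toℕ i) p ℕ.≟ m i ⌋) (allFin (suc r)))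
       ∧ ⌊ numLow r b p ℕ.≟ j ⌋)
  (𝒫 n r))

-- Cut a path of length (r+1)n into n blocks of r + 1 steps. Positions ≡ i (mod r+1) are
-- the steps at offset i of the blocks, so the residue conditions only prescribe in how many
-- blocks offset i carries a step of the kind b counted (down in part 1, up in part 2), and
-- block starts are the positions ≡ 0. A block with d down steps changes the level by
-- (r+1)(1 − d), so the blocks start at levels (r+1)·Y for the walk Y with increments 1 − d,
-- which add up to n − (n − 1) = 1. The column counts and the number of down steps are
-- invariant under cyclic rotation of the blocks, and by the cycle lemma exactly one of the
-- n rotations starts with a marked block (one starting with a step of kind b) and has
-- exactly j marked blocks starting at a nonpositive level: rank the marked blocks by
-- (level, −index) and rotate at the one of rank j. Hence n times the count is the number
-- of block sequences with prescribed column counts, ∏ C(n, mᵢ), and the absorption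
-- identity k·C(n, k) = n·C(n − 1, k − 1) gives the formula.

module Submission where

open import Defs
open import Data.Bool using (Bool; true; false; _∧_; not; if_then_else_)
import Data.Bool as Bool
open import Data.Bool.Properties using (∧-identityʳ; ∧-zeroʳ)
open import Data.Bool.ListAction using (and)
open import Data.Nat using (ℕ; zero; suc; _+_; _*_; _∸_; _≤_; _<_; z≤n; s≤s; _≟_; _≤?_; _%_)
open import Data.Nat.Properties
open import Data.Nat.DivMod using ([m+kn]%n≡m%n; m<n⇒m%n≡m; m*n%n≡0)
open import Data.Nat.Combinatorics using (_C_; nC1≡n; nCk+nC[k+1]≡[n+1]C[k+1])
open import Data.Nat.ListAction using (sum; product)
open import Data.Nat.ListAction.Properties using (sum-++)
open import Data.Nat.Tactic.RingSolver using (solve-∀)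
open import Data.Integer using (ℤ; 0ℤ; 1ℤ; -1ℤ; pred)
import Data.Integer as ℤ
import Data.Integer.Properties as ℤ
import Data.Integer.Tactic.RingSolver as ℤ
open import Data.Fin using (Fin; zero; suc; toℕ)
import Data.Fin as Fin
open import Data.List
  using (List; []; _∷_; [_]; map; _++_; length; concat; take; drop; upTo; cartesianProductWith; filterᵇ; allFin)
open import Data.List.Properties
  using (map-∘; map-cong; map-tabulate; map-++; map-applyUpTo; length-upTo; length-++; length-map; length-take;
         take++drop≡id; drop-map; take-map; concat-++)
open import Data.List.Membership.Propositional using (_∈_)
open import Data.List.Membership.Propositional.Properties using (∈-++⁻; ∈-map⁻; ∈-upTo⁻; ∈-allFin)
open import Data.List.Relation.Unary.All as All using (All; []; _∷_)
open import Data.List.Relation.Unary.Any using (here; there)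
open import Data.List.Relation.Unary.Unique.Propositional using (Unique; []; _∷_)
open import Data.Product using (_×_; _,_; proj₁; proj₂; ∃₂)
open import Data.Sum using (_⊎_; inj₁; inj₂)
open import Function using (_∘_; id)
open import Relation.Nullary using (Dec; yes; no; ¬_; contradiction)
open import Relation.Nullary.Decidable using (⌊_⌋; _⊎-dec_; _×-dec_)
open import Relation.Binary using (tri<; tri≈; tri>)
open import Relation.Binary.PropositionalEquality
  using (_≡_; _≢_; refl; sym; trans; cong; cong₂; subst; module ≡-Reasoning)

private variable A B X : Set

𝟙 : Bool → ℕ
𝟙 true = 1
𝟙 false = 0

𝟙-∧ : ∀ a c → 𝟙 (a ∧ c) ≡ 𝟙 a * 𝟙 c
𝟙-∧ true c = sym (+-identityʳ (𝟙 c))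
𝟙-∧ false c = refl

𝟙≤1 : ∀ a → 𝟙 a ≤ 1
𝟙≤1 true = ≤-refl
𝟙≤1 false = z≤n

isYes-true : ∀ (a? : Dec A) → A → ⌊ a? ⌋ ≡ true
isYes-true (yes _) _ = refl
isYes-true (no ¬a) a = contradiction a ¬a

isYes-false : ∀ (a? : Dec A) → ¬ A → ⌊ a? ⌋ ≡ false
isYes-false (yes a) ¬a = contradiction a ¬a
isYes-false (no _) _ = refl

isYes-true⁻ : ∀ (a? : Dec A) → ⌊ a? ⌋ ≡ true → A
isYes-true⁻ (yes a) _ = a

isYes-cong : ∀ (a? : Dec A) (b? : Dec B) → (A → B) → (B → A) → ⌊ a? ⌋ ≡ ⌊ b? ⌋
isYes-cong a? (yes b) _ g = isYes-true a? (g b)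
isYes-cong a? (no ¬b) f _ = isYes-false a? (¬b ∘ f)

𝟙-isYes-mono : ∀ (a? : Dec A) (b? : Dec B) → (A → B) → 𝟙 ⌊ a? ⌋ ≤ 𝟙 ⌊ b? ⌋
𝟙-isYes-mono (yes a) b? f rewrite isYes-true b? (f a) = ≤-refl
𝟙-isYes-mono (no _) b? f = z≤n

𝟙-isYes-< : ∀ (a? : Dec A) (b? : Dec B) → ¬ A → B → 𝟙 ⌊ a? ⌋ < 𝟙 ⌊ b? ⌋
𝟙-isYes-< a? b? ¬a b rewrite isYes-false a? ¬a | isYes-true b? b = ≤-refl

∧-isYes-false : ∀ c (a? : Dec A) → ¬ A → c ∧ ⌊ a? ⌋ ≡ false
∧-isYes-false c a? ¬a = trans (cong (c ∧_) (isYes-false a? ¬a)) (∧-zeroʳ c)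

∧-true⁻ : ∀ {a c} → a ∧ c ≡ true → a ≡ true × c ≡ true
∧-true⁻ {true} c≡true = refl , c≡true

δ : ℕ → ℕ → ℕ
δ a b = 𝟙 ⌊ a ≟ b ⌋

δ-refl : ∀ a → δ a a ≡ 1
δ-refl a = cong 𝟙 (isYes-true (a ≟ a) refl)

δ-≢ : ∀ {a b} → a ≢ b → δ a b ≡ 0
δ-≢ {a} {b} a≢b = cong 𝟙 (isYes-false (a ≟ b) a≢b)

δ-suc : ∀ a b → δ (suc a) (suc b) ≡ δ a b
δ-suc a b = cong 𝟙 (isYes-cong (suc a ≟ suc b) (a ≟ b) suc-injective (cong suc))

δ-< : ∀ {a b} → a < b → δ a b ≡ 0
δ-< a<b = δ-≢ (λ { refl → <-irrefl refl a<b })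

δ-> : ∀ {a b} → b < a → δ a b ≡ 0
δ-> b<a = δ-≢ (λ { refl → <-irrefl refl b<a })

∑ : List A → (A → ℕ) → ℕ
∑ xs f = sum (map f xs)

∑-++ : ∀ (xs ys : List A) f → ∑ (xs ++ ys) f ≡ ∑ xs f + ∑ ys f
∑-++ xs ys f = trans (cong sum (map-++ f xs ys)) (sum-++ (map f xs) (map f ys))

∑-cong : ∀ (xs : List A) {f g} → (∀ x → x ∈ xs → f x ≡ g x) → ∑ xs f ≡ ∑ xs g
∑-cong [] eq = refl
∑-cong (x ∷ xs) eq = cong₂ _+_ (eq x (here refl)) (∑-cong xs (λ y y∈xs → eq y (there y∈xs)))

∑-ext : ∀ (xs : List A) {f g} → (∀ x → f x ≡ g x) → ∑ xs f ≡ ∑ xs g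
∑-ext xs eq = ∑-cong xs (λ x _ → eq x)

∑-+ : ∀ (xs : List A) f g → ∑ xs (λ x → f x + g x) ≡ ∑ xs f + ∑ xs g
∑-+ [] f g = refl
∑-+ (x ∷ xs) f g = trans (cong (f x + g x +_) (∑-+ xs f g)) (interchange (f x) (g x) (∑ xs f) (∑ xs g))
  where
  interchange : ∀ a b c d → a + b + (c + d) ≡ a + c + (b + d)
  interchange = solve-∀

∑-*ˡ : ∀ (xs : List A) c f → ∑ xs (λ x → c * f x) ≡ c * ∑ xs f
∑-*ˡ [] c f = sym (*-zeroʳ c)
∑-*ˡ (x ∷ xs) c f = trans (cong (c * f x +_) (∑-*ˡ xs c f)) (sym (*-distribˡ-+ c (f x) (∑ xs f)))

∑-const : ∀ (xs : List A) c → ∑ xs (λ _ → c) ≡ length xs * c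
∑-const [] c = refl
∑-const (x ∷ xs) c = cong (c +_) (∑-const xs c)

∑-const-0 : ∀ (xs : List A) → ∑ xs (λ _ → 0) ≡ 0
∑-const-0 xs = trans (∑-const xs 0) (*-zeroʳ (length xs))

∑-swap : ∀ (xs : List A) (ys : List B) (f : A → B → ℕ) →
         ∑ xs (λ x → ∑ ys (f x)) ≡ ∑ ys (λ y → ∑ xs (λ x → f x y))
∑-swap [] ys f = sym (∑-const-0 ys)
∑-swap (x ∷ xs) ys f = trans (cong (∑ ys (f x) +_) (∑-swap xs ys f))
                              (sym (∑-+ ys (f x) (λ y → ∑ xs (λ x → f x y))))

∑-map : ∀ (h : B → A) (ys : List B) f → ∑ (map h ys) f ≡ ∑ ys (f ∘ h)
∑-map h ys f = cong sum (sym (map-∘ ys))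

∑-cartesianProductWith : ∀ (h : A → B → X) (xs : List A) (ys : List B) f →
  ∑ (cartesianProductWith h xs ys) f ≡ ∑ xs (λ x → ∑ ys (λ y → f (h x y)))
∑-cartesianProductWith h [] ys f = refl
∑-cartesianProductWith h (x ∷ xs) ys f =
  trans (∑-++ (map (h x) ys) _ f)
        (cong₂ _+_ (∑-map (h x) ys f) (∑-cartesianProductWith h xs ys f))

∈-cartesianProductWith⁻ : ∀ (h : A → B → X) (xs : List A) {ys : List B} {z} →
  z ∈ cartesianProductWith h xs ys → ∃₂ λ x y → x ∈ xs × y ∈ ys × z ≡ h x y
∈-cartesianProductWith⁻ h (x ∷ xs) {ys} z∈ with ∈-++⁻ (map (h x) ys) z∈
... | inj₁ z∈map with ∈-map⁻ (h x) z∈map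
...   | y , y∈ys , refl = x , y , here refl , y∈ys , refl
∈-cartesianProductWith⁻ h (x ∷ xs) {ys} z∈ | inj₂ z∈rest with ∈-cartesianProductWith⁻ h xs z∈rest
... | x′ , y , x′∈xs , y∈ys , eq = x′ , y , there x′∈xs , y∈ys , eq

∑-mono-≤ : ∀ (xs : List A) {f g} → (∀ x → x ∈ xs → f x ≤ g x) → ∑ xs f ≤ ∑ xs g
∑-mono-≤ [] le = z≤n
∑-mono-≤ (x ∷ xs) le = +-mono-≤ (le x (here refl)) (∑-mono-≤ xs (λ y y∈ → le y (there y∈)))

∑-mono-< : ∀ (xs : List A) {f g y} → y ∈ xs → f y < g y →
           (∀ x → x ∈ xs → f x ≤ g x) → ∑ xs f < ∑ xs g
∑-mono-< (x ∷ xs) (here refl) lt le = +-mono-<-≤ lt (∑-mono-≤ xs (λ y y∈ → le y (there y∈)))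
∑-mono-< (x ∷ xs) (there y∈) lt le =
  +-mono-≤-< (le x (here refl)) (∑-mono-< xs y∈ lt (λ y y∈ → le y (there y∈)))

∑-𝟙≤length : ∀ (xs : List A) (P : A → Bool) → ∑ xs (𝟙 ∘ P) ≤ length xs
∑-𝟙≤length [] P = z≤n
∑-𝟙≤length (x ∷ xs) P = +-mono-≤ (𝟙≤1 (P x)) (∑-𝟙≤length xs P)

length-filterᵇ : ∀ (P : A → Bool) xs → length (filterᵇ P xs) ≡ ∑ xs (𝟙 ∘ P)
length-filterᵇ P [] = refl
length-filterᵇ P (x ∷ xs) with P x
... | true = cong suc (length-filterᵇ P xs)
... | false = length-filterᵇ P xs

∑-concat : ∀ (xss : List (List A)) f → ∑ (concat xss) f ≡ ∑ xss (λ xs → ∑ xs f)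
∑-concat [] f = refl
∑-concat (xs ∷ xss) f = trans (∑-++ xs (concat xss) f) (cong (∑ xs f +_) (∑-concat xss f))

∑-filterᵇ : ∀ (P : A → Bool) xs f → ∑ (filterᵇ P xs) f ≡ ∑ xs (λ x → 𝟙 (P x) * f x)
∑-filterᵇ P [] f = refl
∑-filterᵇ P (x ∷ xs) f with P x
... | true = cong₂ _+_ (sym (+-identityʳ (f x))) (∑-filterᵇ P xs f)
... | false = ∑-filterᵇ P xs f

∑-upTo-suc : ∀ m f → ∑ (upTo (suc m)) f ≡ f 0 + ∑ (upTo m) (f ∘ suc)
∑-upTo-suc m f = cong (f 0 +_)
  (trans (cong (λ xs → ∑ xs f) (sym (map-applyUpTo id suc m))) (∑-map suc (upTo m) f))

∏ : List A → (A → ℕ) → ℕ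
∏ xs f = product (map f xs)

∏-* : ∀ (xs : List A) f g → ∏ xs (λ x → f x * g x) ≡ ∏ xs f * ∏ xs g
∏-* [] f g = refl
∏-* (x ∷ xs) f g = trans (cong (f x * g x *_) (∏-* xs f g)) (interchange (f x) (g x) (∏ xs f) (∏ xs g))
  where
  interchange : ∀ a b c d → a * b * (c * d) ≡ a * c * (b * d)
  interchange = solve-∀

∏-ext : ∀ (xs : List A) {f g} → (∀ x → f x ≡ g x) → ∏ xs f ≡ ∏ xs g
∏-ext xs eq = cong product (map-cong eq xs)

𝟙-and : ∀ (xs : List A) (P : A → Bool) → 𝟙 (and (map P xs)) ≡ ∏ xs (𝟙 ∘ P)
𝟙-and [] P = refl
𝟙-and (x ∷ xs) P = trans (𝟙-∧ (P x) _) (cong (𝟙 (P x) *_) (𝟙-and xs P))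

and-true⁻ : ∀ (xs : List A) (P : A → Bool) → and (map P xs) ≡ true → ∀ x → x ∈ xs → P x ≡ true
and-true⁻ (y ∷ xs) P all-true x x∈ with P y in eq
and-true⁻ (y ∷ xs) P all-true x (here refl) | true = eq
and-true⁻ (y ∷ xs) P all-true x (there x∈) | true = and-true⁻ xs P all-true x x∈

∑-allFin-suc : ∀ L (f : Fin (suc L) → ℕ) → ∑ (allFin (suc L)) f ≡ f zero + ∑ (allFin L) (f ∘ suc)
∑-allFin-suc L f = cong (f zero +_) (cong sum (trans (map-tabulate suc f) (sym (map-tabulate id (f ∘ suc)))))

∏-allFin-suc : ∀ L (f : Fin (suc L) → ℕ) → ∏ (allFin (suc L)) f ≡ f zero * ∏ (allFin L) (f ∘ suc)
∏-allFin-suc L f = cong (f zero *_) (cong product (trans (map-tabulate suc f) (sym (map-tabulate id (f ∘ suc)))))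

rotate : ℕ → List A → List A
rotate t xs = drop t xs ++ take t xs

rotate-++ : ∀ (us vs : List A) → rotate (length us) (us ++ vs) ≡ vs ++ us
rotate-++ us vs = cong₂ _++_ (drop-length us) (take-length us)
  where
  drop-length : ∀ us → drop (length us) (us ++ vs) ≡ vs
  drop-length [] = refl
  drop-length (u ∷ us) = drop-length us
  take-length : ∀ us → take (length us) (us ++ vs) ≡ us
  take-length [] = refl
  take-length (u ∷ us) = cong (u ∷_) (take-length us)

rotate-invariant : ∀ (f : List A → ℕ) → (∀ u v → f (u ++ v) ≡ f u + f v) → ∀ t xs → f (rotate t xs) ≡ f xs
rotate-invariant f additive t xs = begin
  f (drop t xs ++ take t xs)   ≡⟨ additive (drop t xs) (take t xs) ⟩
  f (drop t xs) + f (take t xs) ≡⟨ +-comm (f (drop t xs)) _ ⟩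
  f (take t xs) + f (drop t xs) ≡⟨ additive (take t xs) (drop t xs) ⟨
  f (take t xs ++ drop t xs)   ≡⟨ cong f (take++drop≡id t xs) ⟩
  f xs                         ∎
  where open ≡-Reasoning

-- Sums over paths and over sequences of blocks

∑-allPaths-suc : ∀ L (g : Path → ℕ) →
  ∑ (allPaths (suc L)) g ≡ ∑ (allPaths L) (g ∘ (true ∷_)) + ∑ (allPaths L) (g ∘ (false ∷_))
∑-allPaths-suc L g = trans (∑-++ (map (true ∷_) (allPaths L)) _ g)
  (cong₂ _+_ (∑-map (true ∷_) (allPaths L) g) (∑-map (false ∷_) (allPaths L) g))

∈-allPaths⇒length : ∀ L {w} → w ∈ allPaths L → length w ≡ L
∈-allPaths⇒length zero (here refl) = refl
∈-allPaths⇒length (suc L) w∈ with ∈-++⁻ (map (true ∷_) (allPaths L)) w∈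
... | inj₁ w∈ₜ with ∈-map⁻ (true ∷_) w∈ₜ
...   | v , v∈ , refl = cong suc (∈-allPaths⇒length L v∈)
∈-allPaths⇒length (suc L) w∈ | inj₂ w∈f with ∈-map⁻ (false ∷_) w∈f
...   | v , v∈ , refl = cong suc (∈-allPaths⇒length L v∈)

∑-allPaths-++ : ∀ a b (g : Path → ℕ) →
  ∑ (allPaths (a + b)) g ≡ ∑ (allPaths a) (λ u → ∑ (allPaths b) (λ v → g (u ++ v)))
∑-allPaths-++ zero b g = sym (+-identityʳ _)
∑-allPaths-++ (suc a) b g = begin
  ∑ (allPaths (suc a + b)) g
    ≡⟨ ∑-allPaths-suc (a + b) g ⟩
  ∑ (allPaths (a + b)) (g ∘ (true ∷_)) + ∑ (allPaths (a + b)) (g ∘ (false ∷_))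
    ≡⟨ cong₂ _+_ (∑-allPaths-++ a b (g ∘ (true ∷_))) (∑-allPaths-++ a b (g ∘ (false ∷_))) ⟩
  ∑ (allPaths a) (λ u → ∑ (allPaths b) (λ v → g (true ∷ u ++ v)))
    + ∑ (allPaths a) (λ u → ∑ (allPaths b) (λ v → g (false ∷ u ++ v)))
    ≡⟨ ∑-allPaths-suc a (λ u → ∑ (allPaths b) (λ v → g (u ++ v))) ⟨
  ∑ (allPaths (suc a)) (λ u → ∑ (allPaths b) (λ v → g (u ++ v))) ∎
  where open ≡-Reasoning

module BlockSequences (R : ℕ) where

  blockSeqs : ℕ → List (List Path)
  blockSeqs zero = [ [] ]
  blockSeqs (suc n) = cartesianProductWith _∷_ (allPaths R) (blockSeqs n)

  Sized : List Path → Set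
  Sized = All (λ B → length B ≡ R)

  BlockSeq : ℕ → List Path → Set
  BlockSeq n bs = length bs ≡ n × Sized bs

  ∈-blockSeqs⇒BlockSeq : ∀ n {bs} → bs ∈ blockSeqs n → BlockSeq n bs
  ∈-blockSeqs⇒BlockSeq zero (here refl) = refl , []
  ∈-blockSeqs⇒BlockSeq (suc n) bs∈ with ∈-cartesianProductWith⁻ _∷_ (allPaths R) bs∈
  ... | B , cs , B∈ , cs∈ , refl with ∈-blockSeqs⇒BlockSeq n cs∈
  ...   | len , lens = cong suc len , ∈-allPaths⇒length R B∈ ∷ lens

  length-concat : ∀ n {bs} → BlockSeq n bs → length (concat bs) ≡ R * n
  length-concat zero {[]} _ = sym (*-zeroʳ R)
  length-concat (suc n) {B ∷ bs} (length≡ , lB ∷ sized) =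
    trans (length-++ B) (trans (cong₂ _+_ lB (length-concat n (suc-injective length≡ , sized))) (sym (*-suc R n)))

  ∑-blockSeqs-cong : ∀ n {f g : List Path → ℕ} →
    (∀ bs → BlockSeq n bs → f bs ≡ g bs) → ∑ (blockSeqs n) f ≡ ∑ (blockSeqs n) g
  ∑-blockSeqs-cong n eq = ∑-cong (blockSeqs n) (λ bs bs∈ → eq bs (∈-blockSeqs⇒BlockSeq n bs∈))

  ∑-blockSeqs-suc : ∀ n (g : List Path → ℕ) →
    ∑ (blockSeqs (suc n)) g ≡ ∑ (allPaths R) (λ B → ∑ (blockSeqs n) (g ∘ (B ∷_)))
  ∑-blockSeqs-suc n g = ∑-cartesianProductWith _∷_ (allPaths R) (blockSeqs n) g

  ∑-blockSeqs-++ : ∀ a b (g : List Path → ℕ) →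
    ∑ (blockSeqs (a + b)) g ≡ ∑ (blockSeqs a) (λ us → ∑ (blockSeqs b) (λ vs → g (us ++ vs)))
  ∑-blockSeqs-++ zero b g = sym (+-identityʳ _)
  ∑-blockSeqs-++ (suc a) b g = trans (∑-blockSeqs-suc (a + b) g)
    (trans (∑-ext (allPaths R) (λ B → ∑-blockSeqs-++ a b (g ∘ (B ∷_))))
           (sym (∑-blockSeqs-suc a _)))

  ∑-allPaths-concat : ∀ n (g : Path → ℕ) → ∑ (allPaths (R * n)) g ≡ ∑ (blockSeqs n) (g ∘ concat)
  ∑-allPaths-concat zero g = cong (λ L → ∑ (allPaths L) g) (*-zeroʳ R)
  ∑-allPaths-concat (suc n) g = begin
    ∑ (allPaths (R * suc n)) g
      ≡⟨ cong (λ L → ∑ (allPaths L) g) (*-suc R n) ⟩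
    ∑ (allPaths (R + R * n)) g
      ≡⟨ ∑-allPaths-++ R (R * n) g ⟩
    ∑ (allPaths R) (λ B → ∑ (allPaths (R * n)) (g ∘ (B ++_)))
      ≡⟨ ∑-ext (allPaths R) (λ B → ∑-allPaths-concat n (g ∘ (B ++_))) ⟩
    ∑ (allPaths R) (λ B → ∑ (blockSeqs n) (g ∘ concat ∘ (B ∷_)))
      ≡⟨ ∑-blockSeqs-suc n (g ∘ concat) ⟨
    ∑ (blockSeqs (suc n)) (g ∘ concat) ∎
    where open ≡-Reasoning

  ∑-blockSeqs-rotate : ∀ n t (g : List Path → ℕ) → t ≤ n →
    ∑ (blockSeqs n) (g ∘ rotate t) ≡ ∑ (blockSeqs n) g
  ∑-blockSeqs-rotate n t g t≤n rewrite sym (m+[n∸m]≡n t≤n) = begin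
    ∑ (blockSeqs (t + k)) (g ∘ rotate t)
      ≡⟨ ∑-blockSeqs-++ t k (g ∘ rotate t) ⟩
    ∑ (blockSeqs t) (λ us → ∑ (blockSeqs k) (λ vs → g (rotate t (us ++ vs))))
      ≡⟨ ∑-blockSeqs-cong t (λ { us (refl , _) → ∑-ext (blockSeqs k) (λ vs → cong g (rotate-++ us vs)) }) ⟩
    ∑ (blockSeqs t) (λ us → ∑ (blockSeqs k) (λ vs → g (vs ++ us)))
      ≡⟨ ∑-swap (blockSeqs t) (blockSeqs k) (λ us vs → g (vs ++ us)) ⟩
    ∑ (blockSeqs k) (λ vs → ∑ (blockSeqs t) (λ us → g (vs ++ us)))
      ≡⟨ ∑-blockSeqs-++ k t g ⟨
    ∑ (blockSeqs (k + t)) g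
      ≡⟨ cong (λ m → ∑ (blockSeqs m) g) (+-comm k t) ⟩
    ∑ (blockSeqs (t + k)) g ∎
    where
    open ≡-Reasoning
    k : ℕ
    k = n ∸ t

  ∑-blockSeqs-rotations : ∀ n (F : List Path → ℕ) →
    n * ∑ (blockSeqs n) F ≡ ∑ (blockSeqs n) (λ bs → ∑ (upTo n) (λ t → F (rotate t bs)))
  ∑-blockSeqs-rotations n F = begin
    n * ∑ (blockSeqs n) F
      ≡⟨ cong (_* ∑ (blockSeqs n) F) (length-upTo n) ⟨
    length (upTo n) * ∑ (blockSeqs n) F
      ≡⟨ ∑-const (upTo n) _ ⟨
    ∑ (upTo n) (λ _ → ∑ (blockSeqs n) F)
      ≡⟨ ∑-cong (upTo n) (λ t t∈ → sym (∑-blockSeqs-rotate n t F (<⇒≤ (∈-upTo⁻ t∈)))) ⟩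
    ∑ (upTo n) (λ t → ∑ (blockSeqs n) (F ∘ rotate t))
      ≡⟨ ∑-swap (upTo n) (blockSeqs n) (λ t bs → F (rotate t bs)) ⟩
    ∑ (blockSeqs n) (λ bs → ∑ (upTo n) (λ t → F (rotate t bs))) ∎
    where open ≡-Reasoning

-- Ranks and the cycle lemma

module Ranking {A : Set} (_≼_ : A → A → Set) (_≼?_ : ∀ x y → Dec (x ≼ y))
  (≼-refl : ∀ {x} → x ≼ x) (≼-trans : ∀ {x y z} → x ≼ y → y ≼ z → x ≼ z)
  (≼-antisym : ∀ {x y} → x ≼ y → y ≼ x → x ≡ y) (≼-total : ∀ {x y} → ¬ x ≼ y → y ≼ x) where

  open ≡-Reasoning

  rank : List A → A → ℕ
  rank L x = ∑ L (λ z → 𝟙 ⌊ z ≼? x ⌋)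

  rank-mono : ∀ L {x y} → x ≼ y → rank L x ≤ rank L y
  rank-mono L x≼y = ∑-mono-≤ L (λ z _ → 𝟙-isYes-mono (z ≼? _) (z ≼? _) (λ z≼x → ≼-trans z≼x x≼y))

  rank-strictMono : ∀ L {x y} → All (x ≢_) L → y ∈ L → x ≼ y → rank L x < rank L y
  rank-strictMono L {x} {y} x∉L y∈L x≼y =
    ∑-mono-< L y∈L (𝟙-isYes-< (y ≼? x) (y ≼? y) y⋠x ≼-refl)
      (λ z _ → 𝟙-isYes-mono (z ≼? x) (z ≼? y) (λ z≼x → ≼-trans z≼x x≼y))
    where
    y⋠x : ¬ y ≼ x
    y⋠x y≼x = All.lookup x∉L y∈L (≼-antisym x≼y y≼x)

  rank-∷ : ∀ {x} L → All (x ≢_) L → ∀ y → y ∈ L →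
    (rank (x ∷ L) y ≡ suc (rank L y) × rank L x < rank L y) ⊎ (rank (x ∷ L) y ≡ rank L y × rank L y ≤ rank L x)
  rank-∷ {x} L x∉L y y∈L with x ≼? y
  ... | yes x≼y = inj₁ (refl , rank-strictMono L x∉L y∈L x≼y)
  ... | no x⋠y = inj₂ (refl , rank-mono L (≼-total x⋠y))

  rank-hits-once : ∀ L → Unique L → ∀ j → 1 ≤ j → j ≤ length L → ∑ L (λ y → δ (rank L y) j) ≡ 1
  rank-hits-once [] [] (suc j) _ ()
  rank-hits-once (x ∷ L) (x∉L ∷ uniq) j 1≤j j≤1+L
    rewrite isYes-true (x ≼? x) ≼-refl with rank L x | rank-∷ L x∉L | ∑-𝟙≤length L (λ z → ⌊ z ≼? x ⌋)
  ... | ρ | split | ρ≤L with <-cmp j (suc ρ)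
  ... | tri< j≤ρ _ _ = begin
    δ (suc ρ) j + ∑ L (λ y → δ (rank (x ∷ L) y) j) ≡⟨ cong₂ _+_ (δ-> j≤ρ) (∑-cong L unchanged) ⟩
    ∑ L (λ y → δ (rank L y) j)                     ≡⟨ rank-hits-once L uniq j 1≤j (≤-trans (≤-pred j≤ρ) ρ≤L) ⟩
    1                                              ∎
    where
    unchanged : ∀ y → y ∈ L → δ (rank (x ∷ L) y) j ≡ δ (rank L y) j
    unchanged y y∈L with split y y∈L
    ... | inj₁ (eq , ρ<rank) = trans (cong (λ k → δ k j) eq)
          (trans (δ-> (<-≤-trans j≤ρ (≤-trans ρ<rank (n≤1+n _)))) (sym (δ-> (<-≤-trans j≤ρ ρ<rank))))
    ... | inj₂ (eq , _) = cong (λ k → δ k j) eq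
  ... | tri≈ _ refl _ = begin
    δ (suc ρ) (suc ρ) + ∑ L (λ y → δ (rank (x ∷ L) y) (suc ρ)) ≡⟨ cong₂ _+_ (δ-refl (suc ρ)) (∑-cong L missed) ⟩
    1 + ∑ L (λ _ → 0)                                          ≡⟨ cong (1 +_) (∑-const-0 L) ⟩
    1                                                          ∎
    where
    missed : ∀ y → y ∈ L → δ (rank (x ∷ L) y) (suc ρ) ≡ 0
    missed y y∈L with split y y∈L
    ... | inj₁ (eq , ρ<rank) = trans (cong (λ k → δ k (suc ρ)) eq) (δ-> (s≤s ρ<rank))
    ... | inj₂ (eq , rank≤ρ) = trans (cong (λ k → δ k (suc ρ)) eq) (δ-< (s≤s rank≤ρ))
  ... | tri> _ _ ρ+1<j with j | ρ+1<j | j≤1+L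
  ...   | suc j′ | s≤s ρ<j′ | s≤s j′≤L = begin
    δ (suc ρ) (suc j′) + ∑ L (λ y → δ (rank (x ∷ L) y) (suc j′)) ≡⟨ cong₂ _+_ (δ-< (s≤s ρ<j′)) (∑-cong L shifted) ⟩
    ∑ L (λ y → δ (rank L y) j′)                                  ≡⟨ rank-hits-once L uniq j′ (≤-trans (s≤s z≤n) ρ<j′) j′≤L ⟩
    1                                                            ∎
    where
    shifted : ∀ y → y ∈ L → δ (rank (x ∷ L) y) (suc j′) ≡ δ (rank L y) j′
    shifted y y∈L with split y y∈L
    ... | inj₁ (eq , _) = trans (cong (λ k → δ k (suc j′)) eq) (δ-suc (rank L y) j′)
    ... | inj₂ (eq , rank≤ρ) = trans (cong (λ k → δ k (suc j′)) eq)
          (trans (δ-< (≤-trans (s≤s rank≤ρ) (≤-trans ρ<j′ (n≤1+n j′)))) (sym (δ-< (≤-trans (s≤s rank≤ρ) ρ<j′))))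

Key : Set
Key = ℤ × ℕ

_≼_ : Key → Key → Set
(p , i) ≼ (q , t) = p ℤ.< q ⊎ (p ≡ q × t ≤ i)

_≼?_ : ∀ x y → Dec (x ≼ y)
(p , i) ≼? (q , t) = (p ℤ.<? q) ⊎-dec ((p ℤ.≟ q) ×-dec (t ≤? i))

≼-refl : ∀ {x} → x ≼ x
≼-refl = inj₂ (refl , ≤-refl)

≼-trans : ∀ {x y z} → x ≼ y → y ≼ z → x ≼ z
≼-trans (inj₁ p<q) (inj₁ q<u) = inj₁ (ℤ.<-trans p<q q<u)
≼-trans (inj₁ p<q) (inj₂ (refl , _)) = inj₁ p<q
≼-trans (inj₂ (refl , _)) (inj₁ q<u) = inj₁ q<u
≼-trans (inj₂ (refl , t≤i)) (inj₂ (refl , s≤t)) = inj₂ (refl , ≤-trans s≤t t≤i)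

≼-antisym : ∀ {x y} → x ≼ y → y ≼ x → x ≡ y
≼-antisym (inj₁ p<q) (inj₁ q<p) = contradiction q<p (ℤ.<-asym p<q)
≼-antisym (inj₁ p<q) (inj₂ (refl , _)) = contradiction p<q (ℤ.<-irrefl refl)
≼-antisym (inj₂ (refl , _)) (inj₁ q<p) = contradiction q<p (ℤ.<-irrefl refl)
≼-antisym (inj₂ (refl , t≤i)) (inj₂ (_ , i≤t)) = cong (_ ,_) (≤-antisym i≤t t≤i)

≼-total : ∀ {x y} → ¬ x ≼ y → y ≼ x
≼-total {p , i} {q , t} x⋠y with ℤ.<-cmp p q
... | tri< p<q _ _ = contradiction (inj₁ p<q) x⋠y
... | tri> _ _ q<p = inj₁ q<p
... | tri≈ _ refl _ with t ≤? i
...   | yes t≤i = contradiction (inj₂ (refl , t≤i)) x⋠y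
...   | no t≰i = inj₂ (refl , <⇒≤ (≰⇒> t≰i))

open Ranking _≼_ _≼?_ ≼-refl ≼-trans ≼-antisym ≼-total

-- An item is a mark together with an increment of level.
Item : Set
Item = Bool × ℤ

total : List Item → ℤ
total [] = 0ℤ
total ((_ , a) ∷ s) = a ℤ.+ total s

marks : List Item → ℕ
marks [] = 0
marks ((c , _) ∷ s) = 𝟙 c + marks s

headMarked : List Item → Bool
headMarked [] = false
headMarked ((c , _) ∷ _) = c

lowMarks : ℤ → List Item → ℕ
lowMarks y [] = 0
lowMarks y ((c , a) ∷ s) = 𝟙 (c ∧ ⌊ y ℤ.≤? 0ℤ ⌋) + lowMarks (y ℤ.+ a) s

markKeys : ℤ → ℕ → List Item → List Key
markKeys y k [] = []
markKeys y k ((true , a) ∷ s) = (y , k) ∷ markKeys (y ℤ.+ a) (suc k) s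
markKeys y k ((false , a) ∷ s) = markKeys (y ℤ.+ a) (suc k) s

total-++ : ∀ u v → total (u ++ v) ≡ total u ℤ.+ total v
total-++ [] v = sym (ℤ.+-identityˡ (total v))
total-++ ((_ , a) ∷ u) v = trans (cong (λ z → a ℤ.+ z) (total-++ u v)) (sym (ℤ.+-assoc a (total u) (total v)))

lowMarks-++ : ∀ y u v → lowMarks y (u ++ v) ≡ lowMarks y u + lowMarks (y ℤ.+ total u) v
lowMarks-++ y [] v = cong (λ z → lowMarks z v) (sym (ℤ.+-identityʳ y))
lowMarks-++ y ((c , a) ∷ u) v = begin
  𝟙 (c ∧ ⌊ y ℤ.≤? 0ℤ ⌋) + lowMarks (y ℤ.+ a) (u ++ v)
    ≡⟨ cong (𝟙 (c ∧ ⌊ y ℤ.≤? 0ℤ ⌋) +_) (lowMarks-++ (y ℤ.+ a) u v) ⟩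
  𝟙 (c ∧ ⌊ y ℤ.≤? 0ℤ ⌋) + (lowMarks (y ℤ.+ a) u + lowMarks (y ℤ.+ a ℤ.+ total u) v)
    ≡⟨ cong (λ z → 𝟙 (c ∧ ⌊ y ℤ.≤? 0ℤ ⌋) + (lowMarks (y ℤ.+ a) u + lowMarks z v)) (ℤ.+-assoc y a (total u)) ⟩
  𝟙 (c ∧ ⌊ y ℤ.≤? 0ℤ ⌋) + (lowMarks (y ℤ.+ a) u + lowMarks (y ℤ.+ (a ℤ.+ total u)) v)
    ≡⟨ Data.Nat.Properties.+-assoc (𝟙 (c ∧ ⌊ y ℤ.≤? 0ℤ ⌋)) _ _ ⟨
  lowMarks y ((c , a) ∷ u) + lowMarks (y ℤ.+ total ((c , a) ∷ u)) v ∎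
  where open ≡-Reasoning

markKeys-++ : ∀ y k u v → markKeys y k (u ++ v) ≡ markKeys y k u ++ markKeys (y ℤ.+ total u) (k + length u) v
markKeys-++ y k [] v = cong₂ (λ z i → markKeys z i v) (sym (ℤ.+-identityʳ y)) (sym (+-identityʳ k))
markKeys-++ y k ((c , a) ∷ u) v with markKeys-++ (y ℤ.+ a) (suc k) u v
... | ih rewrite ℤ.+-assoc y a (total u) | +-suc k (length u) with c
...   | true = cong ((y , k) ∷_) ih
...   | false = ih

length-markKeys : ∀ y k s → length (markKeys y k s) ≡ marks s
length-markKeys y k [] = refl
length-markKeys y k ((true , a) ∷ s) = cong suc (length-markKeys (y ℤ.+ a) (suc k) s)
length-markKeys y k ((false , a) ∷ s) = length-markKeys (y ℤ.+ a) (suc k) s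

IndexIn : ℕ → ℕ → Key → Set
IndexIn k m z = k ≤ proj₂ z × proj₂ z < k + m

IndexIn-suc : ∀ {k m} z → IndexIn (suc k) m z → IndexIn k (suc m) z
IndexIn-suc {k} {m} z (k<i , i<) = <⇒≤ k<i , subst (proj₂ z <_) (sym (+-suc k m)) i<

markKeys-indexIn : ∀ y k s → All (IndexIn k (length s)) (markKeys y k s)
markKeys-indexIn y k [] = []
markKeys-indexIn y k ((true , a) ∷ s) =
  (≤-refl , m<m+n k (s≤s z≤n)) ∷ All.map (λ {z} → IndexIn-suc z) (markKeys-indexIn (y ℤ.+ a) (suc k) s)
markKeys-indexIn y k ((false , a) ∷ s) = All.map (λ {z} → IndexIn-suc z) (markKeys-indexIn (y ℤ.+ a) (suc k) s)

markKeys-unique : ∀ y k s → Unique (markKeys y k s)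
markKeys-unique y k [] = []
markKeys-unique y k ((true , a) ∷ s) =
  All.map (λ { (k<i , _) refl → <-irrefl refl k<i }) (markKeys-indexIn (y ℤ.+ a) (suc k) s)
  ∷ markKeys-unique (y ℤ.+ a) (suc k) s
markKeys-unique y k ((false , a) ∷ s) = markKeys-unique (y ℤ.+ a) (suc k) s

private
  shift : ∀ y a w → y ℤ.+ a ℤ.- w ≡ y ℤ.- w ℤ.+ a
  shift = ℤ.solve-∀

lowMarks-∑ : ∀ y k w s → ∑ (markKeys y k s) (λ z → 𝟙 ⌊ proj₁ z ℤ.≤? w ⌋) ≡ lowMarks (y ℤ.- w) s
lowMarks-∑ y k w [] = refl
lowMarks-∑ y k w ((true , a) ∷ s) =
  cong₂ _+_ (cong 𝟙 (isYes-cong (y ℤ.≤? w) (y ℤ.- w ℤ.≤? 0ℤ) ℤ.i≤j⇒i-j≤0 ℤ.i-j≤0⇒i≤j))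
            (trans (lowMarks-∑ (y ℤ.+ a) (suc k) w s) (cong (λ z → lowMarks z s) (shift y a w)))
lowMarks-∑ y k w ((false , a) ∷ s) =
  trans (lowMarks-∑ (y ℤ.+ a) (suc k) w s) (cong (λ z → lowMarks z s) (shift y a w))

∑-markKeys : ∀ (g : Key → ℕ) y k s →
  ∑ (upTo (length s)) (λ t → 𝟙 (headMarked (drop t s)) * g (y ℤ.+ total (take t s) , k + t))
    ≡ ∑ (markKeys y k s) g
∑-markKeys g y k [] = refl
∑-markKeys g y k ((c , a) ∷ s) = begin
  ∑ (upTo (suc (length s)))
    (λ t → 𝟙 (headMarked (drop t ((c , a) ∷ s))) * g (y ℤ.+ total (take t ((c , a) ∷ s)) , k + t))
    ≡⟨ ∑-upTo-suc (length s) _ ⟩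
  𝟙 c * g (y ℤ.+ 0ℤ , k + 0)
    + ∑ (upTo (length s)) (λ t → 𝟙 (headMarked (drop t s)) * g (y ℤ.+ (a ℤ.+ total (take t s)) , k + suc t))
    ≡⟨ cong₂ _+_ (cong (λ z → 𝟙 c * g z) (cong₂ _,_ (ℤ.+-identityʳ y) (+-identityʳ k)))
                 (∑-ext (upTo (length s)) (λ t → cong (λ z → 𝟙 (headMarked (drop t s)) * g z)
                   (cong₂ _,_ (sym (ℤ.+-assoc y a (total (take t s)))) (+-suc k t)))) ⟩
  𝟙 c * g (y , k)
    + ∑ (upTo (length s)) (λ t → 𝟙 (headMarked (drop t s)) * g (y ℤ.+ a ℤ.+ total (take t s) , suc k + t))
    ≡⟨ cong (𝟙 c * g (y , k) +_) (∑-markKeys g (y ℤ.+ a) (suc k) s) ⟩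
  𝟙 c * g (y , k) + ∑ (markKeys (y ℤ.+ a) (suc k) s) g
    ≡⟨ markKeys-∷ c ⟩
  ∑ (markKeys y k ((c , a) ∷ s)) g ∎
  where
  open ≡-Reasoning
  markKeys-∷ : ∀ c → 𝟙 c * g (y , k) + ∑ (markKeys (y ℤ.+ a) (suc k) s) g ≡ ∑ (markKeys y k ((c , a) ∷ s)) g
  markKeys-∷ true = cong (_+ ∑ (markKeys (y ℤ.+ a) (suc k) s) g) (Data.Nat.Properties.*-identityˡ (g (y , k)))
  markKeys-∷ false = refl

≼-at-or-after : ∀ {p i P k} → k ≤ i → ⌊ p ℤ.≤? P ⌋ ≡ ⌊ (p , i) ≼? (P , k) ⌋
≼-at-or-after {p} {i} {P} {k} k≤i = isYes-cong (p ℤ.≤? P) ((p , i) ≼? (P , k)) to from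
  where
  to : p ℤ.≤ P → (p , i) ≼ (P , k)
  to p≤P with ℤ.<-cmp p P
  ... | tri< p<P _ _ = inj₁ p<P
  ... | tri≈ _ p≡P _ = inj₂ (p≡P , k≤i)
  ... | tri> _ _ P<p = contradiction p≤P (ℤ.<⇒≱ P<p)
  from : (p , i) ≼ (P , k) → p ℤ.≤ P
  from (inj₁ p<P) = ℤ.<⇒≤ p<P
  from (inj₂ (refl , _)) = ℤ.≤-refl

≼-before : ∀ {p i P k} → i < k → ⌊ p ℤ.≤? pred P ⌋ ≡ ⌊ (p , i) ≼? (P , k) ⌋
≼-before {p} {i} {P} {k} i<k = isYes-cong (p ℤ.≤? pred P) ((p , i) ≼? (P , k)) to from
  where
  to : p ℤ.≤ pred P → (p , i) ≼ (P , k)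
  to p≤P-1 = inj₁ (ℤ.i≤pred[j]⇒i<j p≤P-1)
  from : (p , i) ≼ (P , k) → p ℤ.≤ pred P
  from (inj₁ p<P) = ℤ.i<j⇒i≤pred[j] p<P
  from (inj₂ (_ , k≤i)) = contradiction (≤-trans i<k k≤i) (<-irrefl refl)

rank-of-later-keys : ∀ P t v → lowMarks 0ℤ v ≡ rank (markKeys P t v) (P , t)
rank-of-later-keys P t v = begin
  lowMarks 0ℤ v                                  ≡⟨ cong (λ y → lowMarks y v) (ℤ.+-inverseʳ P) ⟨
  lowMarks (P ℤ.- P) v                           ≡⟨ lowMarks-∑ P t P v ⟨
  ∑ (markKeys P t v) (λ z → 𝟙 ⌊ proj₁ z ℤ.≤? P ⌋) ≡⟨ ∑-cong (markKeys P t v) (λ z z∈ →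
                                                      cong 𝟙 (≼-at-or-after (proj₁ (All.lookup (markKeys-indexIn P t v) z∈)))) ⟩
  rank (markKeys P t v) (P , t)                  ∎
  where open ≡-Reasoning

rank-of-earlier-keys : ∀ P u → lowMarks (1ℤ ℤ.- P) u ≡ rank (markKeys 0ℤ 0 u) (P , length u)
rank-of-earlier-keys P u = begin
  lowMarks (1ℤ ℤ.- P) u                                ≡⟨ cong (λ y → lowMarks y u) (1-P≡0-[-1+P] P) ⟩
  lowMarks (0ℤ ℤ.- pred P) u                           ≡⟨ lowMarks-∑ 0ℤ 0 (pred P) u ⟨
  ∑ (markKeys 0ℤ 0 u) (λ z → 𝟙 ⌊ proj₁ z ℤ.≤? pred P ⌋) ≡⟨ ∑-cong (markKeys 0ℤ 0 u) (λ z z∈ →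
                                                            cong 𝟙 (≼-before (proj₂ (All.lookup (markKeys-indexIn 0ℤ 0 u) z∈)))) ⟩
  rank (markKeys 0ℤ 0 u) (P , length u)                ∎
  where
  open ≡-Reasoning
  1-P≡0-[-1+P] : ∀ P → 1ℤ ℤ.- P ≡ 0ℤ ℤ.- (-1ℤ ℤ.+ P)
  1-P≡0-[-1+P] = ℤ.solve-∀

-- After rotating s at t, the items from t on start lower by P = total (take t s) and
-- those before t higher by 1 − P; so a marked item starts at a nonpositive level
-- exactly when its key is ≼ (P , t).
lowMarks-rotate : ∀ s t → total s ≡ 1ℤ → t ≤ length s →
  lowMarks 0ℤ (rotate t s) ≡ rank (markKeys 0ℤ 0 s) (total (take t s) , t)
lowMarks-rotate s t total≡1 t≤ = begin
  lowMarks 0ℤ (v ++ u)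
    ≡⟨ lowMarks-++ 0ℤ v u ⟩
  lowMarks 0ℤ v + lowMarks (0ℤ ℤ.+ total v) u
    ≡⟨ cong₂ _+_ (rank-of-later-keys P t v) (cong (λ y → lowMarks y u) level-of-u) ⟩
  rank (markKeys P t v) (P , t) + lowMarks (1ℤ ℤ.- P) u
    ≡⟨ cong₂ _+_ refl (trans (rank-of-earlier-keys P u) (cong (λ i → rank (markKeys 0ℤ 0 u) (P , i)) length-u)) ⟩
  rank (markKeys P t v) (P , t) + rank (markKeys 0ℤ 0 u) (P , t)
    ≡⟨ trans (+-comm (rank (markKeys P t v) (P , t)) _) (sym (∑-++ (markKeys 0ℤ 0 u) (markKeys P t v) _)) ⟩
  rank (markKeys 0ℤ 0 u ++ markKeys P t v) (P , t)
    ≡⟨ cong₂ (λ y k → rank (markKeys 0ℤ 0 u ++ markKeys y k v) (P , t)) (sym (ℤ.+-identityˡ P)) (sym length-u) ⟩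
  rank (markKeys 0ℤ 0 u ++ markKeys (0ℤ ℤ.+ P) (0 + length u) v) (P , t)
    ≡⟨ cong (λ L → rank L (P , t)) (markKeys-++ 0ℤ 0 u v) ⟨
  rank (markKeys 0ℤ 0 (u ++ v)) (P , t)
    ≡⟨ cong (λ w → rank (markKeys 0ℤ 0 w) (P , t)) (take++drop≡id t s) ⟩
  rank (markKeys 0ℤ 0 s) (P , t) ∎
  where
  open ≡-Reasoning
  u v : List Item
  u = take t s
  v = drop t s
  P : ℤ
  P = total u
  length-u : length u ≡ t
  length-u = trans (length-take t s) (m≤n⇒m⊓n≡m t≤)
  level-of-u : 0ℤ ℤ.+ total v ≡ 1ℤ ℤ.- P
  level-of-u = trans (solve P (total v))
    (cong (λ T → T ℤ.- P) (trans (sym (total-++ u v)) (trans (cong total (take++drop≡id t s)) total≡1)))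
    where
    solve : ∀ P w → 0ℤ ℤ.+ w ≡ P ℤ.+ w ℤ.- P
    solve = ℤ.solve-∀

headMarked-drop-++ : ∀ s t w → t < length s → headMarked (drop t s ++ w) ≡ headMarked (drop t s)
headMarked-drop-++ (x ∷ s) zero w _ = refl
headMarked-drop-++ (x ∷ s) (suc t) w (s≤s t<) = headMarked-drop-++ s t w t<

cycle-lemma : ∀ s j → total s ≡ 1ℤ → 1 ≤ j → j ≤ marks s →
  ∑ (upTo (length s)) (λ t → 𝟙 (headMarked (rotate t s) ∧ ⌊ lowMarks 0ℤ (rotate t s) ≟ j ⌋)) ≡ 1
cycle-lemma s j total≡1 1≤j j≤marks = begin
  ∑ (upTo (length s)) (λ t → 𝟙 (headMarked (rotate t s) ∧ ⌊ lowMarks 0ℤ (rotate t s) ≟ j ⌋))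
    ≡⟨ ∑-cong (upTo (length s)) (λ t t∈ → rotation-term t (∈-upTo⁻ t∈)) ⟩
  ∑ (upTo (length s)) (λ t → 𝟙 (headMarked (drop t s)) * hits (0ℤ ℤ.+ total (take t s) , 0 + t))
    ≡⟨ ∑-markKeys hits 0ℤ 0 s ⟩
  ∑ K hits
    ≡⟨ rank-hits-once K (markKeys-unique 0ℤ 0 s) j 1≤j (subst (j ≤_) (sym (length-markKeys 0ℤ 0 s)) j≤marks) ⟩
  1 ∎
  where
  open ≡-Reasoning
  K : List Key
  K = markKeys 0ℤ 0 s
  hits : Key → ℕ
  hits z = δ (rank K z) j
  rotation-term : ∀ t → t < length s →
    𝟙 (headMarked (rotate t s) ∧ ⌊ lowMarks 0ℤ (rotate t s) ≟ j ⌋)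
      ≡ 𝟙 (headMarked (drop t s)) * hits (0ℤ ℤ.+ total (take t s) , t)
  rotation-term t t< = trans (𝟙-∧ (headMarked (rotate t s)) _)
    (cong₂ _*_ (cong 𝟙 (headMarked-drop-++ s t (take t s) t<))
               (cong (λ z → δ z j) (trans (lowMarks-rotate s t total≡1 (<⇒≤ t<))
                                          (cong (λ p → rank K (p , t)) (sym (ℤ.+-identityˡ _))))))

-- Reading the steps of a path off its blocks

numDown-++ : ∀ u v → numDown (u ++ v) ≡ numDown u + numDown v
numDown-++ u v = trans (length-filterᵇ not (u ++ v))
  (trans (∑-++ u v _) (sym (cong₂ _+_ (length-filterᵇ not u) (length-filterᵇ not v))))

numDown≡∑ : ∀ p → numDown p ≡ ∑ p (λ s → 𝟙 ⌊ s Bool.≟ false ⌋)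
numDown≡∑ [] = refl
numDown≡∑ (true ∷ p) = numDown≡∑ p
numDown≡∑ (false ∷ p) = cong suc (numDown≡∑ p)

ups+downs≡length : ∀ p → ∑ p (λ s → 𝟙 ⌊ s Bool.≟ true ⌋) + numDown p ≡ length p
ups+downs≡length [] = refl
ups+downs≡length (true ∷ p) = cong suc (ups+downs≡length p)
ups+downs≡length (false ∷ p) = trans (+-suc _ (numDown p)) (cong suc (ups+downs≡length p))

module PathBlocks (r : ℕ) where

  R : ℕ
  R = suc r

  open BlockSequences R using (Sized)

  nextLevel : ℤ → Bool → ℤ
  nextLevel y s = if s then y ℤ.+ ℤ.+ 1 else y ℤ.- ℤ.+ r

  endLevel : ℤ → Path → ℤ
  endLevel y [] = y
  endLevel y (s ∷ p) = endLevel (nextLevel y s) p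

  annotate-++ : ∀ x y u v → annotate r x y (u ++ v) ≡ annotate r x y u ++ annotate r (x + length u) (endLevel y u) v
  annotate-++ x y [] v = cong (λ z → annotate r z y v) (sym (+-identityʳ x))
  annotate-++ x y (s ∷ u) v = cong ((x , y , s) ∷_)
    (trans (annotate-++ (suc x) (nextLevel y s) u v)
           (cong (λ z → annotate r (suc x) (nextLevel y s) u ++ annotate r z (endLevel (nextLevel y s) u) v)
                 (sym (+-suc x (length u)))))

  endLevel-closed : ∀ y B → endLevel y B ≡ y ℤ.+ ℤ.+ length B ℤ.- ℤ.+ R ℤ.* ℤ.+ numDown B
  endLevel-closed y [] = solve y (ℤ.+ R)
    where
    solve : ∀ y R → y ≡ y ℤ.+ 0ℤ ℤ.- R ℤ.* 0ℤ
    solve = ℤ.solve-∀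
  endLevel-closed y (true ∷ B) = trans (endLevel-closed (y ℤ.+ 1ℤ) B) (up y (ℤ.+ length B) (ℤ.+ R) (ℤ.+ numDown B))
    where
    up : ∀ y L R d → y ℤ.+ 1ℤ ℤ.+ L ℤ.- R ℤ.* d ≡ y ℤ.+ (1ℤ ℤ.+ L) ℤ.- R ℤ.* d
    up = ℤ.solve-∀
  endLevel-closed y (false ∷ B) = trans (endLevel-closed (y ℤ.- ℤ.+ r) B) (down y (ℤ.+ length B) (ℤ.+ r) (ℤ.+ numDown B))
    where
    down : ∀ y L r d → y ℤ.- r ℤ.+ L ℤ.- (1ℤ ℤ.+ r) ℤ.* d ≡ y ℤ.+ (1ℤ ℤ.+ L) ℤ.- (1ℤ ℤ.+ r) ℤ.* (1ℤ ℤ.+ d)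
    down = ℤ.solve-∀

  atResidue : Bool → ℕ → ℕ × ℤ × Bool → Bool
  atResidue b i (x , _ , s) = ⌊ s Bool.≟ b ⌋ ∧ ⌊ x % R ≟ i ⌋

  lowAtZero : Bool → ℕ × ℤ × Bool → Bool
  lowAtZero b (x , y , s) = ⌊ s Bool.≟ b ⌋ ∧ ⌊ x % R ≟ 0 ⌋ ∧ ⌊ y ℤ.≤? 0ℤ ⌋

  numAt-∑ : ∀ b i p → numAt r b i p ≡ ∑ (steps r p) (𝟙 ∘ atResidue b i)
  numAt-∑ b i p = trans (length-filterᵇ _ (steps r p)) (∑-ext (steps r p) (λ _ → refl))

  numLow-∑ : ∀ b p → numLow r b p ≡ ∑ (steps r p) (𝟙 ∘ lowAtZero b)
  numLow-∑ b p = trans (length-filterᵇ _ (steps r p)) (∑-ext (steps r p) (λ _ → refl))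

  hasAt : Bool → ℕ → Path → Bool
  hasAt b i [] = false
  hasAt b zero (s ∷ B) = ⌊ s Bool.≟ b ⌋
  hasAt b (suc i) (s ∷ B) = hasAt b i B

  column : Bool → ℕ → List Path → ℕ
  column b i bs = ∑ bs (𝟙 ∘ hasAt b i)

  offset-% : ∀ q k → q < R → (q + k * R) % R ≡ q
  offset-% q k q<R = trans ([m+kn]%n≡m%n q k R) (m<n⇒m%n≡m q<R)

  fits-∷ : ∀ {q} {s : Bool} {B : Path} → q + length (s ∷ B) ≤ R → q < R × suc q + length B ≤ R
  fits-∷ {q} {s} {B} fits = ≤-trans (s≤s (m≤m+n q (length B))) fits′ , fits′
    where
    fits′ : suc q + length B ≤ R
    fits′ = subst (_≤ R) (+-suc q (length B)) fits

  atResidue-offset : ∀ b i q k y s → q < R → atResidue b i (q + k * R , y , s) ≡ ⌊ s Bool.≟ b ⌋ ∧ ⌊ q ≟ i ⌋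
  atResidue-offset b i q k y s q<R = cong (λ x → ⌊ s Bool.≟ b ⌋ ∧ ⌊ x ≟ i ⌋) (offset-% q k q<R)

  block-silent : ∀ (P : ℕ × ℤ × Bool → Bool) q k y B →
    (∀ q′ y′ s → q ≤ q′ → q′ < R → P (q′ + k * R , y′ , s) ≡ false) → q + length B ≤ R →
    ∑ (annotate r (q + k * R) y B) (𝟙 ∘ P) ≡ 0
  block-silent P q k y [] _ _ = refl
  block-silent P q k y (s ∷ B) silent fits with fits-∷ {q} {s} {B} fits
  ... | q<R , fits′ = cong₂ _+_ (cong 𝟙 (silent q y s ≤-refl q<R))
    (block-silent P (suc q) k (nextLevel y s) B (λ q′ y′ s q<q′ → silent q′ y′ s (<⇒≤ q<q′)) fits′)

  block-atResidue : ∀ b q i k y B → q + length B ≤ R →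
    ∑ (annotate r (q + k * R) y B) (𝟙 ∘ atResidue b (q + i)) ≡ 𝟙 (hasAt b i B)
  block-atResidue b q i k y [] _ = refl
  block-atResidue b q zero k y (s ∷ B) fits with fits-∷ {q} {s} {B} fits
  ... | q<R , fits′ = begin
    𝟙 (atResidue b (q + 0) (q + k * R , y , s)) + ∑ (annotate r (suc q + k * R) (nextLevel y s) B) (𝟙 ∘ atResidue b (q + 0))
      ≡⟨ cong₂ _+_ (cong 𝟙 (trans (atResidue-offset b (q + 0) q k y s q<R)
                                   (cong (⌊ s Bool.≟ b ⌋ ∧_) (isYes-true (q ≟ q + 0) (sym (+-identityʳ q))))))
                   (block-silent _ (suc q) k _ B later fits′) ⟩
    𝟙 (⌊ s Bool.≟ b ⌋ ∧ true) + 0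
      ≡⟨ trans (+-identityʳ _) (cong 𝟙 (∧-identityʳ _)) ⟩
    𝟙 ⌊ s Bool.≟ b ⌋ ∎
    where
    open ≡-Reasoning
    later : ∀ q′ y′ s′ → suc q ≤ q′ → q′ < R → atResidue b (q + 0) (q′ + k * R , y′ , s′) ≡ false
    later q′ y′ s′ q<q′ q′<R = trans (atResidue-offset b (q + 0) q′ k y′ s′ q′<R)
      (∧-isYes-false _ (q′ ≟ q + 0) (λ eq → <-irrefl (sym eq) (subst (_< q′) (sym (+-identityʳ q)) q<q′)))
  block-atResidue b q (suc i) k y (s ∷ B) fits with fits-∷ {q} {s} {B} fits
  ... | q<R , fits′ = begin
    𝟙 (atResidue b (q + suc i) (q + k * R , y , s))
      + ∑ (annotate r (suc q + k * R) (nextLevel y s) B) (𝟙 ∘ atResidue b (q + suc i))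
      ≡⟨ cong₂ _+_ (cong 𝟙 (trans (atResidue-offset b (q + suc i) q k y s q<R)
                                   (∧-isYes-false _ (q ≟ q + suc i) (λ eq → <-irrefl eq (m<m+n q (s≤s z≤n))))))
                   (cong (λ i′ → ∑ (annotate r (suc q + k * R) (nextLevel y s) B) (𝟙 ∘ atResidue b i′)) (+-suc q i)) ⟩
    ∑ (annotate r (suc q + k * R) (nextLevel y s) B) (𝟙 ∘ atResidue b (suc q + i))
      ≡⟨ block-atResidue b (suc q) i k _ B fits′ ⟩
    𝟙 (hasAt b i B) ∎
    where open ≡-Reasoning

  block-lowAtZero : ∀ b k y B → length B ≤ R →
    ∑ (annotate r (k * R) y B) (𝟙 ∘ lowAtZero b) ≡ 𝟙 (startsWith b B ∧ ⌊ y ℤ.≤? 0ℤ ⌋)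
  block-lowAtZero b k y [] _ = refl
  block-lowAtZero b k y (s ∷ B) (s≤s fits) = begin
    𝟙 (⌊ s Bool.≟ b ⌋ ∧ ⌊ k * R % R ≟ 0 ⌋ ∧ ⌊ y ℤ.≤? 0ℤ ⌋) + ∑ (annotate r (1 + k * R) _ B) (𝟙 ∘ lowAtZero b)
      ≡⟨ cong₂ _+_ (cong (λ n → 𝟙 (⌊ s Bool.≟ b ⌋ ∧ ⌊ n ≟ 0 ⌋ ∧ ⌊ y ℤ.≤? 0ℤ ⌋)) (m*n%n≡0 k R))
                   (block-silent _ 1 k _ B later (s≤s fits)) ⟩
    𝟙 (⌊ s Bool.≟ b ⌋ ∧ ⌊ y ℤ.≤? 0ℤ ⌋) + 0
      ≡⟨ +-identityʳ _ ⟩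
    𝟙 (⌊ s Bool.≟ b ⌋ ∧ ⌊ y ℤ.≤? 0ℤ ⌋) ∎
    where
    open ≡-Reasoning
    later : ∀ q′ y′ s′ → 1 ≤ q′ → q′ < R → lowAtZero b (q′ + k * R , y′ , s′) ≡ false
    later q′ y′ s′ 1≤q′ q′<R rewrite offset-% q′ k q′<R | isYes-false (q′ ≟ 0) (λ { refl → <-irrefl refl 1≤q′ }) =
      ∧-zeroʳ ⌊ s′ Bool.≟ b ⌋

  ∑-annotate-block : ∀ (f : ℕ × ℤ × Bool → ℕ) k y B bs → length B ≡ R →
    ∑ (annotate r (k * R) y (B ++ concat bs)) f
      ≡ ∑ (annotate r (k * R) y B) f + ∑ (annotate r (suc k * R) (endLevel y B) (concat bs)) f
  ∑-annotate-block f k y B bs lB = begin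
    ∑ (annotate r (k * R) y (B ++ concat bs)) f
      ≡⟨ cong (λ zs → ∑ zs f) (annotate-++ (k * R) y B (concat bs)) ⟩
    ∑ (annotate r (k * R) y B ++ annotate r (k * R + length B) (endLevel y B) (concat bs)) f
      ≡⟨ ∑-++ (annotate r (k * R) y B) _ f ⟩
    ∑ (annotate r (k * R) y B) f + ∑ (annotate r (k * R + length B) (endLevel y B) (concat bs)) f
      ≡⟨ cong (λ x → ∑ (annotate r (k * R) y B) f + ∑ (annotate r x (endLevel y B) (concat bs)) f)
              (trans (cong (k * R +_) lB) (+-comm (k * R) R)) ⟩
    ∑ (annotate r (k * R) y B) f + ∑ (annotate r (suc k * R) (endLevel y B) (concat bs)) f ∎
    where open ≡-Reasoning

  numAt-concat : ∀ b i bs → Sized bs → numAt r b i (concat bs) ≡ column b i bs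
  numAt-concat b i bs sized = trans (numAt-∑ b i (concat bs)) (go 0 0ℤ bs sized)
    where
    go : ∀ k y bs → Sized bs → ∑ (annotate r (k * R) y (concat bs)) (𝟙 ∘ atResidue b i) ≡ column b i bs
    go k y [] [] = refl
    go k y (B ∷ bs) (lB ∷ sized) = trans (∑-annotate-block (𝟙 ∘ atResidue b i) k y B bs lB)
      (cong₂ _+_ (block-atResidue b 0 i k y B (≤-reflexive lB)) (go (suc k) (endLevel y B) bs sized))

  R*Y≤0⇔Y≤0 : ∀ Y → ⌊ ℤ.+ R ℤ.* Y ℤ.≤? 0ℤ ⌋ ≡ ⌊ Y ℤ.≤? 0ℤ ⌋
  R*Y≤0⇔Y≤0 Y = isYes-cong (ℤ.+ R ℤ.* Y ℤ.≤? 0ℤ) (Y ℤ.≤? 0ℤ)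
    (λ le → ℤ.*-cancelˡ-≤-pos Y 0ℤ (ℤ.+ R) (subst (ℤ.+ R ℤ.* Y ℤ.≤_) (sym (ℤ.*-zeroʳ (ℤ.+ R))) le))
    (λ le → subst (ℤ.+ R ℤ.* Y ℤ.≤_) (ℤ.*-zeroʳ (ℤ.+ R)) (ℤ.*-monoˡ-≤-nonNeg (ℤ.+ R) le))

  endLevel-block : ∀ Y B → length B ≡ R → endLevel (ℤ.+ R ℤ.* Y) B ≡ ℤ.+ R ℤ.* (Y ℤ.+ (1ℤ ℤ.- ℤ.+ numDown B))
  endLevel-block Y B lB = trans (endLevel-closed _ B)
    (trans (cong (λ L → ℤ.+ R ℤ.* Y ℤ.+ ℤ.+ L ℤ.- ℤ.+ R ℤ.* ℤ.+ numDown B) lB) (distrib (ℤ.+ R) Y (ℤ.+ numDown B)))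
    where
    distrib : ∀ R Y d → R ℤ.* Y ℤ.+ R ℤ.- R ℤ.* d ≡ R ℤ.* (Y ℤ.+ (1ℤ ℤ.- d))
    distrib = ℤ.solve-∀

  -- A block becomes an item, marked when it starts with a step of kind b; its increment is
  -- the block's change of level divided by R.
  items : Bool → List Path → List Item
  items b = map (λ B → startsWith b B , 1ℤ ℤ.- ℤ.+ numDown B)

  numLow-concat : ∀ b bs → Sized bs → numLow r b (concat bs) ≡ lowMarks 0ℤ (items b bs)
  numLow-concat b bs sized = begin
    numLow r b (concat bs)                                            ≡⟨ numLow-∑ b (concat bs) ⟩
    ∑ (annotate r (0 * R) 0ℤ (concat bs)) (𝟙 ∘ lowAtZero b)           ≡⟨ cong (λ y → ∑ (annotate r 0 y (concat bs)) (𝟙 ∘ lowAtZero b))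
                                                                             (sym (ℤ.*-zeroʳ (ℤ.+ R))) ⟩
    ∑ (annotate r (0 * R) (ℤ.+ R ℤ.* 0ℤ) (concat bs)) (𝟙 ∘ lowAtZero b) ≡⟨ go 0 0ℤ bs sized ⟩
    lowMarks 0ℤ (items b bs) ∎
    where
    open ≡-Reasoning
    go : ∀ k Y bs → Sized bs →
      ∑ (annotate r (k * R) (ℤ.+ R ℤ.* Y) (concat bs)) (𝟙 ∘ lowAtZero b) ≡ lowMarks Y (items b bs)
    go k Y [] [] = refl
    go k Y (B ∷ bs) (lB ∷ sized) = trans (∑-annotate-block (𝟙 ∘ lowAtZero b) k _ B bs lB)
      (cong₂ _+_ (trans (block-lowAtZero b k _ B (≤-reflexive lB)) (cong (λ c → 𝟙 (startsWith b B ∧ c)) (R*Y≤0⇔Y≤0 Y)))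
                 (trans (cong (λ y → ∑ (annotate r (suc k * R) y (concat bs)) (𝟙 ∘ lowAtZero b)) (endLevel-block Y B lB))
                        (go (suc k) _ bs sized)))

  startsWith-concat : ∀ b bs → Sized bs → startsWith b (concat bs) ≡ headMarked (items b bs)
  startsWith-concat b [] [] = refl
  startsWith-concat b ([] ∷ bs) (() ∷ _)
  startsWith-concat b ((s ∷ B) ∷ bs) _ = refl

  total-items : ∀ b bs → total (items b bs) ≡ ℤ.+ length bs ℤ.- ℤ.+ numDown (concat bs)
  total-items b [] = refl
  total-items b (B ∷ bs) = begin
    1ℤ ℤ.- ℤ.+ numDown B ℤ.+ total (items b bs)
      ≡⟨ cong (λ z → 1ℤ ℤ.- ℤ.+ numDown B ℤ.+ z) (total-items b bs) ⟩
    1ℤ ℤ.- ℤ.+ numDown B ℤ.+ (ℤ.+ length bs ℤ.- ℤ.+ numDown (concat bs))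
      ≡⟨ regroup (ℤ.+ numDown B) (ℤ.+ length bs) (ℤ.+ numDown (concat bs)) ⟩
    ℤ.+ suc (length bs) ℤ.- (ℤ.+ numDown B ℤ.+ ℤ.+ numDown (concat bs))
      ≡⟨ cong (λ d → ℤ.+ suc (length bs) ℤ.- ℤ.+ d) (numDown-++ B (concat bs)) ⟨
    ℤ.+ suc (length bs) ℤ.- ℤ.+ numDown (B ++ concat bs) ∎
    where
    open ≡-Reasoning
    regroup : ∀ d n D → 1ℤ ℤ.- d ℤ.+ (n ℤ.- D) ≡ 1ℤ ℤ.+ n ℤ.- (d ℤ.+ D)
    regroup = ℤ.solve-∀

  marks-items : ∀ b bs → marks (items b bs) ≡ column b 0 bs
  marks-items b [] = refl
  marks-items b (B ∷ bs) = cong₂ _+_ (cong 𝟙 (startsWith≡hasAt₀ B)) (marks-items b bs)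
    where
    startsWith≡hasAt₀ : ∀ B → startsWith b B ≡ hasAt b 0 B
    startsWith≡hasAt₀ [] = refl
    startsWith≡hasAt₀ (s ∷ B) = refl

  items-rotate : ∀ b t bs → items b (rotate t bs) ≡ rotate t (items b bs)
  items-rotate b t bs = trans (map-++ _ (drop t bs) (take t bs)) (sym (cong₂ _++_ (drop-map t bs) (take-map t bs)))

  ∑-hasAt : ∀ b L B → length B ≡ L → ∑ (allFin L) (λ i → 𝟙 (hasAt b (toℕ i) B)) ≡ ∑ B (λ s → 𝟙 ⌊ s Bool.≟ b ⌋)
  ∑-hasAt b zero [] _ = refl
  ∑-hasAt b (suc L) (s ∷ B) lB = trans (∑-allFin-suc L _) (cong (𝟙 ⌊ s Bool.≟ b ⌋ +_) (∑-hasAt b L B (suc-injective lB)))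

  ∑-column : ∀ b bs → Sized bs → ∑ (allFin R) (λ i → column b (toℕ i) bs) ≡ ∑ (concat bs) (λ s → 𝟙 ⌊ s Bool.≟ b ⌋)
  ∑-column b bs sized = begin
    ∑ (allFin R) (λ i → ∑ bs (λ B → 𝟙 (hasAt b (toℕ i) B))) ≡⟨ ∑-swap (allFin R) bs _ ⟩
    ∑ bs (λ B → ∑ (allFin R) (λ i → 𝟙 (hasAt b (toℕ i) B))) ≡⟨ ∑-cong bs (λ B B∈ → ∑-hasAt b R B (All.lookup sized B∈)) ⟩
    ∑ bs (λ B → ∑ B (λ s → 𝟙 ⌊ s Bool.≟ b ⌋))              ≡⟨ ∑-concat bs _ ⟨
    ∑ (concat bs) (λ s → 𝟙 ⌊ s Bool.≟ b ⌋) ∎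
    where open ≡-Reasoning

δ-+ : ∀ x c m → δ (x + c) m ≡ 𝟙 ⌊ x ≤? m ⌋ * δ c (m ∸ x)
δ-+ zero c m = sym (+-identityʳ (δ c m))
δ-+ (suc x) c zero = refl
δ-+ (suc x) c (suc m) = trans (δ-suc (x + c) m) (trans (δ-+ x c m)
  (cong (λ z → 𝟙 z * δ c (m ∸ x)) (isYes-cong (x ≤? m) (suc x ≤? suc m) s≤s ≤-pred)))

pascal : ∀ n k → 𝟙 ⌊ 1 ≤? k ⌋ * (n C (k ∸ 1)) + 𝟙 ⌊ 0 ≤? k ⌋ * (n C k) ≡ suc n C k
pascal n zero = refl
pascal n (suc k) = trans (cong₂ _+_ (*-identityˡ (n C k)) (*-identityˡ (n C suc k))) (nCk+nC[k+1]≡[n+1]C[k+1] n k)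

choices : ℕ → ℕ → ℕ → ℕ
choices n k x = 𝟙 ⌊ x ≤? k ⌋ * (n C (k ∸ x))

choices-pascal : ∀ b n k → choices n k (𝟙 ⌊ true Bool.≟ b ⌋) + choices n k (𝟙 ⌊ false Bool.≟ b ⌋) ≡ suc n C k
choices-pascal true n k = pascal n k
choices-pascal false n k = trans (+-comm (choices n k 0) _) (pascal n k)

module ColumnCount (r : ℕ) (b : Bool) where
  open PathBlocks r
  open BlockSequences R

  -- Each column of a block is chosen independently (b or not b).
  ∑-allPaths-∏ : ∀ L (h : Fin L → ℕ → ℕ) →
    ∑ (allPaths L) (λ B → ∏ (allFin L) (λ i → h i (𝟙 (hasAt b (toℕ i) B))))
      ≡ ∏ (allFin L) (λ i → h i (𝟙 ⌊ true Bool.≟ b ⌋) + h i (𝟙 ⌊ false Bool.≟ b ⌋))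
  ∑-allPaths-∏ zero h = refl
  ∑-allPaths-∏ (suc L) h = begin
    ∑ (allPaths (suc L)) (λ B → ∏ (allFin (suc L)) (λ i → h i (𝟙 (hasAt b (toℕ i) B))))
      ≡⟨ ∑-allPaths-suc L (λ B → ∏ (allFin (suc L)) (λ i → h i (𝟙 (hasAt b (toℕ i) B)))) ⟩
    ∑ (allPaths L) (λ B → ∏ (allFin (suc L)) (λ i → h i (𝟙 (hasAt b (toℕ i) (true ∷ B)))))
      + ∑ (allPaths L) (λ B → ∏ (allFin (suc L)) (λ i → h i (𝟙 (hasAt b (toℕ i) (false ∷ B)))))
      ≡⟨ cong₂ _+_ (first-step true) (first-step false) ⟩
    h Fin.zero (𝟙 ⌊ true Bool.≟ b ⌋) * rest + h Fin.zero (𝟙 ⌊ false Bool.≟ b ⌋) * rest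
      ≡⟨ *-distribʳ-+ rest (h Fin.zero (𝟙 ⌊ true Bool.≟ b ⌋)) (h Fin.zero (𝟙 ⌊ false Bool.≟ b ⌋)) ⟨
    (h Fin.zero (𝟙 ⌊ true Bool.≟ b ⌋) + h Fin.zero (𝟙 ⌊ false Bool.≟ b ⌋)) * rest
      ≡⟨ ∏-allFin-suc L (λ i → h i (𝟙 ⌊ true Bool.≟ b ⌋) + h i (𝟙 ⌊ false Bool.≟ b ⌋)) ⟨
    ∏ (allFin (suc L)) (λ i → h i (𝟙 ⌊ true Bool.≟ b ⌋) + h i (𝟙 ⌊ false Bool.≟ b ⌋)) ∎
    where
    open ≡-Reasoning
    rest : ℕ
    rest = ∏ (allFin L) (λ i → h (Fin.suc i) (𝟙 ⌊ true Bool.≟ b ⌋) + h (Fin.suc i) (𝟙 ⌊ false Bool.≟ b ⌋))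
    first-step : ∀ s → ∑ (allPaths L) (λ B → ∏ (allFin (suc L)) (λ i → h i (𝟙 (hasAt b (toℕ i) (s ∷ B)))))
                       ≡ h Fin.zero (𝟙 ⌊ s Bool.≟ b ⌋) * rest
    first-step s = trans (∑-ext (allPaths L) (λ B → ∏-allFin-suc L (λ i → h i (𝟙 (hasAt b (toℕ i) (s ∷ B))))))
      (trans (∑-*ˡ (allPaths L) (h Fin.zero (𝟙 ⌊ s Bool.≟ b ⌋)) (λ B → ∏ (allFin L) (λ i → h (Fin.suc i) (𝟙 (hasAt b (toℕ i) B)))))
             (cong (h Fin.zero (𝟙 ⌊ s Bool.≟ b ⌋) *_) (∑-allPaths-∏ L (λ i → h (Fin.suc i)))))

  count-by-columns : ∀ n (m : Fin R → ℕ) →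
    ∑ (blockSeqs n) (λ bs → ∏ (allFin R) (λ i → δ (column b (toℕ i) bs) (m i))) ≡ ∏ (allFin R) (λ i → n C m i)
  count-by-columns zero m = trans (+-identityʳ _) (∏-ext (allFin R) (λ i → δ₀≡0C (m i)))
    where
    δ₀≡0C : ∀ k → δ 0 k ≡ 0 C k
    δ₀≡0C zero = refl
    δ₀≡0C (suc k) = refl
  count-by-columns (suc n) m = begin
    ∑ (blockSeqs (suc n)) (λ bs → ∏ (allFin R) (λ i → δ (column b (toℕ i) bs) (m i)))
      ≡⟨ ∑-blockSeqs-suc n _ ⟩
    ∑ (allPaths R) (λ B → ∑ (blockSeqs n) (λ bs → ∏ (allFin R) (λ i → δ (x B i + column b (toℕ i) bs) (m i))))
      ≡⟨ ∑-ext (allPaths R) first-block ⟩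
    ∑ (allPaths R) (λ B → ∏ (allFin R) (λ i → choices n (m i) (x B i)))
      ≡⟨ ∑-allPaths-∏ R (λ i → choices n (m i)) ⟩
    ∏ (allFin R) (λ i → choices n (m i) (𝟙 ⌊ true Bool.≟ b ⌋) + choices n (m i) (𝟙 ⌊ false Bool.≟ b ⌋))
      ≡⟨ ∏-ext (allFin R) (λ i → choices-pascal b n (m i)) ⟩
    ∏ (allFin R) (λ i → suc n C m i) ∎
    where
    open ≡-Reasoning
    x : Path → Fin R → ℕ
    x B i = 𝟙 (hasAt b (toℕ i) B)
    fits : Path → Fin R → ℕ
    fits B i = 𝟙 ⌊ x B i ≤? m i ⌋
    first-block : ∀ B → ∑ (blockSeqs n) (λ bs → ∏ (allFin R) (λ i → δ (x B i + column b (toℕ i) bs) (m i)))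
                         ≡ ∏ (allFin R) (λ i → choices n (m i) (x B i))
    first-block B = begin
      ∑ (blockSeqs n) (λ bs → ∏ (allFin R) (λ i → δ (x B i + column b (toℕ i) bs) (m i)))
        ≡⟨ ∑-ext (blockSeqs n) (λ bs → trans (∏-ext (allFin R) (λ i → δ-+ (x B i) _ (m i))) (∏-* (allFin R) (fits B) _)) ⟩
      ∑ (blockSeqs n) (λ bs → ∏ (allFin R) (fits B) * ∏ (allFin R) (λ i → δ (column b (toℕ i) bs) (m i ∸ x B i)))
        ≡⟨ ∑-*ˡ (blockSeqs n) (∏ (allFin R) (fits B)) _ ⟩
      ∏ (allFin R) (fits B) * ∑ (blockSeqs n) (λ bs → ∏ (allFin R) (λ i → δ (column b (toℕ i) bs) (m i ∸ x B i)))
        ≡⟨ cong (∏ (allFin R) (fits B) *_) (count-by-columns n (λ i → m i ∸ x B i)) ⟩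
      ∏ (allFin R) (fits B) * ∏ (allFin R) (λ i → n C (m i ∸ x B i))
        ≡⟨ ∏-* (allFin R) (fits B) (λ i → n C (m i ∸ x B i)) ⟨
      ∏ (allFin R) (λ i → choices n (m i) (x B i)) ∎

n-[n∸1]≡1 : ∀ n → 1 ≤ n → ℤ.+ n ℤ.- ℤ.+ (n ∸ 1) ≡ 1ℤ
n-[n∸1]≡1 (suc n) _ = cancel (ℤ.+ n)
  where
  cancel : ∀ x → 1ℤ ℤ.+ x ℤ.- x ≡ 1ℤ
  cancel = ℤ.solve-∀

𝟙-regroup : ∀ d h c l → 𝟙 d * 𝟙 (h ∧ (c ∧ l)) ≡ 𝟙 (d ∧ c) * 𝟙 (h ∧ l)
𝟙-regroup false h c l = refl
𝟙-regroup true false false l = refl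
𝟙-regroup true false true l = refl
𝟙-regroup true true false l = refl
𝟙-regroup true true true l = refl

module Counting (r : ℕ) (b : Bool) (n : ℕ) (m : Fin (suc r) → ℕ) where
  open PathBlocks r
  open BlockSequences R
  open ColumnCount r b

  columnsMatch : List Path → Bool
  columnsMatch bs = and (map (λ i → ⌊ column b (toℕ i) bs ≟ m i ⌋) (allFin R))

  admissible : List Path → Bool
  admissible bs = ⌊ numDown (concat bs) ≟ n ∸ 1 ⌋ ∧ columnsMatch bs

  admissible-rotate : ∀ t bs → admissible (rotate t bs) ≡ admissible bs
  admissible-rotate t bs = cong₂ _∧_
    (cong (λ d → ⌊ d ≟ n ∸ 1 ⌋) (rotate-invariant (numDown ∘ concat) numDown-concat-++ t bs))
    (cong and (map-cong (λ i → cong (λ c → ⌊ c ≟ m i ⌋) (rotate-invariant (column b (toℕ i)) (λ u v → ∑-++ u v _) t bs)) (allFin R)))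
    where
    numDown-concat-++ : ∀ u v → numDown (concat (u ++ v)) ≡ numDown (concat u) + numDown (concat v)
    numDown-concat-++ u v = trans (cong numDown (sym (concat-++ u v))) (numDown-++ (concat u) (concat v))

  -- In both parts of the theorem the prescribed column counts force n − 1 down steps.
  ColumnsFixDowns : Set
  ColumnsFixDowns = ∀ bs → BlockSeq n bs → (∀ i → column b (toℕ i) bs ≡ m i) → numDown (concat bs) ≡ n ∸ 1

  columnsMatch-true⁻ : ∀ bs → columnsMatch bs ≡ true → ∀ i → column b (toℕ i) bs ≡ m i
  columnsMatch-true⁻ bs match i = isYes-true⁻ (column b (toℕ i) bs ≟ m i) (and-true⁻ (allFin R) _ match i (∈-allFin i))

  admissible-true⁻ : ∀ bs → admissible bs ≡ true → numDown (concat bs) ≡ n ∸ 1 × (∀ i → column b (toℕ i) bs ≡ m i)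
  admissible-true⁻ bs adm with ∧-true⁻ {⌊ numDown (concat bs) ≟ n ∸ 1 ⌋} adm
  ... | downs-ok , match = isYes-true⁻ (numDown (concat bs) ≟ n ∸ 1) downs-ok , columnsMatch-true⁻ bs match

  admissible≡columnsMatch : ColumnsFixDowns → ∀ bs → BlockSeq n bs → admissible bs ≡ columnsMatch bs
  admissible≡columnsMatch fix bs seq with columnsMatch bs in match
  ... | false = ∧-zeroʳ _
  ... | true = cong (_∧ true) (isYes-true (numDown (concat bs) ≟ n ∸ 1) (fix bs seq (columnsMatch-true⁻ bs match)))

  module _ (j : ℕ) where

    wins : List Path → Bool
    wins bs = headMarked (items b bs) ∧ ⌊ lowMarks 0ℤ (items b bs) ≟ j ⌋

    count-∑ : count n r b m j ≡ ∑ (blockSeqs n) (λ bs → 𝟙 (admissible bs) * 𝟙 (wins bs))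
    count-∑ = begin
      length (filterᵇ Q (filterᵇ D (allPaths (R * n))))
        ≡⟨ trans (length-filterᵇ Q (filterᵇ D (allPaths (R * n)))) (∑-filterᵇ D (allPaths (R * n)) (𝟙 ∘ Q)) ⟩
      ∑ (allPaths (R * n)) (λ p → 𝟙 (D p) * 𝟙 (Q p))
        ≡⟨ ∑-allPaths-concat n (λ p → 𝟙 (D p) * 𝟙 (Q p)) ⟩
      ∑ (blockSeqs n) (λ bs → 𝟙 (D (concat bs)) * 𝟙 (Q (concat bs)))
        ≡⟨ ∑-blockSeqs-cong n (λ bs (_ , sized) → trans (cong (λ q → 𝟙 (D (concat bs)) * 𝟙 q) (Q-concat bs sized))
            (𝟙-regroup (D (concat bs)) (headMarked (items b bs)) (columnsMatch bs) ⌊ lowMarks 0ℤ (items b bs) ≟ j ⌋)) ⟩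
      ∑ (blockSeqs n) (λ bs → 𝟙 (admissible bs) * 𝟙 (wins bs)) ∎
      where
      open ≡-Reasoning
      D : Path → Bool
      D p = ⌊ numDown p ≟ n ∸ 1 ⌋
      Q : Path → Bool
      Q p = startsWith b p
          ∧ and (map (λ i → ⌊ numAt r b (toℕ i) p ≟ m i ⌋) (allFin (suc r)))
          ∧ ⌊ numLow r b p ≟ j ⌋
      Q-concat : ∀ bs → Sized bs →
        Q (concat bs) ≡ headMarked (items b bs) ∧ (columnsMatch bs ∧ ⌊ lowMarks 0ℤ (items b bs) ≟ j ⌋)
      Q-concat bs sized = cong₂ _∧_ (startsWith-concat b bs sized)
        (cong₂ _∧_ (cong and (map-cong (λ i → cong (λ k → ⌊ k ≟ m i ⌋) (numAt-concat b (toℕ i) bs sized)) (allFin R)))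
                   (cong (λ k → ⌊ k ≟ j ⌋) (numLow-concat b bs sized)))

    wins-once : 1 ≤ n → 1 ≤ j → j ≤ m Fin.zero → ∀ bs → BlockSeq n bs → admissible bs ≡ true →
      ∑ (upTo n) (λ t → 𝟙 (wins (rotate t bs))) ≡ 1
    wins-once 1≤n 1≤j j≤m₀ bs (length≡n , sized) adm = begin
      ∑ (upTo n) (λ t → 𝟙 (wins (rotate t bs)))
        ≡⟨ ∑-ext (upTo n) (λ t → cong (λ s → 𝟙 (headMarked s ∧ ⌊ lowMarks 0ℤ s ≟ j ⌋)) (items-rotate b t bs)) ⟩
      ∑ (upTo n) (λ t → 𝟙 (headMarked (rotate t s) ∧ ⌊ lowMarks 0ℤ (rotate t s) ≟ j ⌋))
        ≡⟨ cong (λ L → ∑ (upTo L) (λ t → 𝟙 (headMarked (rotate t s) ∧ ⌊ lowMarks 0ℤ (rotate t s) ≟ j ⌋))) length-s ⟨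
      ∑ (upTo (length s)) (λ t → 𝟙 (headMarked (rotate t s) ∧ ⌊ lowMarks 0ℤ (rotate t s) ≟ j ⌋))
        ≡⟨ cycle-lemma s j total≡1 1≤j (subst (j ≤_) (sym marks≡m₀) j≤m₀) ⟩
      1 ∎
      where
      open ≡-Reasoning
      s : List Item
      s = items b bs
      length-s : length s ≡ n
      length-s = trans (length-map _ bs) length≡n
      total≡1 : total s ≡ 1ℤ
      total≡1 = trans (total-items b bs)
        (trans (cong₂ (λ L d → ℤ.+ L ℤ.- ℤ.+ d) length≡n (proj₁ (admissible-true⁻ bs adm))) (n-[n∸1]≡1 n 1≤n))
      marks≡m₀ : marks s ≡ m Fin.zero
      marks≡m₀ = trans (marks-items b bs) (proj₂ (admissible-true⁻ bs adm) Fin.zero)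

    ∑-rotations : 1 ≤ n → 1 ≤ j → j ≤ m Fin.zero → ∀ bs → BlockSeq n bs →
      ∑ (upTo n) (λ t → 𝟙 (admissible (rotate t bs)) * 𝟙 (wins (rotate t bs))) ≡ 𝟙 (admissible bs)
    ∑-rotations 1≤n 1≤j j≤m₀ bs seq = begin
      ∑ (upTo n) (λ t → 𝟙 (admissible (rotate t bs)) * 𝟙 (wins (rotate t bs)))
        ≡⟨ ∑-ext (upTo n) (λ t → cong (λ a → 𝟙 a * 𝟙 (wins (rotate t bs))) (admissible-rotate t bs)) ⟩
      ∑ (upTo n) (λ t → 𝟙 (admissible bs) * 𝟙 (wins (rotate t bs)))
        ≡⟨ ∑-*ˡ (upTo n) (𝟙 (admissible bs)) _ ⟩
      𝟙 (admissible bs) * ∑ (upTo n) (λ t → 𝟙 (wins (rotate t bs)))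
        ≡⟨ by-admissibility (admissible bs) refl ⟩
      𝟙 (admissible bs) ∎
      where
      open ≡-Reasoning
      by-admissibility : ∀ a → admissible bs ≡ a → 𝟙 a * ∑ (upTo n) (λ t → 𝟙 (wins (rotate t bs))) ≡ 𝟙 a
      by-admissibility false _ = refl
      by-admissibility true adm = trans (+-identityʳ _) (wins-once 1≤n 1≤j j≤m₀ bs seq adm)

    n*count≡∏C : 1 ≤ n → 1 ≤ j → j ≤ m Fin.zero → ColumnsFixDowns →
      n * count n r b m j ≡ ∏ (allFin R) (λ i → n C m i)
    n*count≡∏C 1≤n 1≤j j≤m₀ fix = begin
      n * count n r b m j
        ≡⟨ cong (n *_) count-∑ ⟩
      n * ∑ (blockSeqs n) (λ bs → 𝟙 (admissible bs) * 𝟙 (wins bs))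
        ≡⟨ ∑-blockSeqs-rotations n _ ⟩
      ∑ (blockSeqs n) (λ bs → ∑ (upTo n) (λ t → 𝟙 (admissible (rotate t bs)) * 𝟙 (wins (rotate t bs))))
        ≡⟨ ∑-blockSeqs-cong n (∑-rotations 1≤n 1≤j j≤m₀) ⟩
      ∑ (blockSeqs n) (λ bs → 𝟙 (admissible bs))
        ≡⟨ ∑-blockSeqs-cong n (λ bs seq → trans (cong 𝟙 (admissible≡columnsMatch fix bs seq)) (𝟙-and (allFin R) _)) ⟩
      ∑ (blockSeqs n) (λ bs → ∏ (allFin R) (λ i → δ (column b (toℕ i) bs) (m i)))
        ≡⟨ count-by-columns n m ⟩
      ∏ (allFin R) (λ i → n C m i) ∎
      where open ≡-Reasoning

[k+1]*[n+1]C[k+1]≡[n+1]*nCk : ∀ n k → suc k * (suc n C suc k) ≡ suc n * (n C k)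
[k+1]*[n+1]C[k+1]≡[n+1]*nCk zero zero = refl
[k+1]*[n+1]C[k+1]≡[n+1]*nCk zero (suc k) = *-zeroʳ (suc (suc k))
[k+1]*[n+1]C[k+1]≡[n+1]*nCk (suc n) zero =
  trans (*-identityˡ (suc (suc n) C 1)) (trans (nC1≡n (suc (suc n))) (sym (*-identityʳ (suc (suc n)))))
[k+1]*[n+1]C[k+1]≡[n+1]*nCk (suc n) (suc k) = begin
  suc K * (suc N C suc K)
    ≡⟨ cong (suc K *_) (nCk+nC[k+1]≡[n+1]C[k+1] N K) ⟨
  suc K * (N C K + N C suc K)
    ≡⟨ *-distribˡ-+ (suc K) (N C K) (N C suc K) ⟩
  (N C K + K * (N C K)) + suc K * (N C suc K)
    ≡⟨ cong₂ (λ x y → (N C K + x) + y) ([k+1]*[n+1]C[k+1]≡[n+1]*nCk n k) ([k+1]*[n+1]C[k+1]≡[n+1]*nCk n K) ⟩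
  (N C K + N * (n C k)) + N * (n C K)
    ≡⟨ regroup (N C K) N (n C k) (n C K) ⟩
  N C K + N * (n C k + n C K)
    ≡⟨ cong (λ x → N C K + N * x) (nCk+nC[k+1]≡[n+1]C[k+1] n k) ⟩
  suc N * (N C K) ∎
  where
  open ≡-Reasoning
  N K : ℕ
  N = suc n
  K = suc k
  regroup : ∀ a N x y → (a + N * x) + N * y ≡ a + N * (x + y)
  regroup = solve-∀

absorb-binomial : ∀ n k c P → 1 ≤ n → 1 ≤ k → n * c ≡ (n C k) * P → k * c ≡ ((n ∸ 1) C (k ∸ 1)) * P
absorb-binomial (suc n) (suc k) c P _ _ eq = *-cancelˡ-≡ (suc k * c) ((n C k) * P) (suc n) (begin
  suc n * (suc k * c)          ≡⟨ swap (suc n) (suc k) c ⟩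
  suc k * (suc n * c)          ≡⟨ cong (suc k *_) eq ⟩
  suc k * ((suc n C suc k) * P) ≡⟨ *-assoc (suc k) (suc n C suc k) P ⟨
  suc k * (suc n C suc k) * P  ≡⟨ cong (_* P) ([k+1]*[n+1]C[k+1]≡[n+1]*nCk n k) ⟩
  suc n * (n C k) * P          ≡⟨ *-assoc (suc n) (n C k) P ⟩
  suc n * ((n C k) * P)        ∎)
  where
  open ≡-Reasoning
  swap : ∀ x y z → x * (y * z) ≡ y * (x * z)
  swap = solve-∀

columnsFixDowns-false : ∀ n r (m : Fin (suc r) → ℕ) → ∑ (allFin (suc r)) m ≡ n ∸ 1 →
  Counting.ColumnsFixDowns r false n m
columnsFixDowns-false n r m sum≡ bs (_ , sized) columns≡ = begin
  numDown (concat bs)                                           ≡⟨ numDown≡∑ (concat bs) ⟩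
  ∑ (concat bs) (λ s → 𝟙 ⌊ s Bool.≟ false ⌋)                     ≡⟨ PathBlocks.∑-column r false bs sized ⟨
  ∑ (allFin (suc r)) (λ i → PathBlocks.column r false (toℕ i) bs) ≡⟨ ∑-ext (allFin (suc r)) columns≡ ⟩
  ∑ (allFin (suc r)) m                                          ≡⟨ sum≡ ⟩
  n ∸ 1                                                         ∎
  where open ≡-Reasoning

columnsFixDowns-true : ∀ n r (m : Fin (suc r) → ℕ) → 1 ≤ n → ∑ (allFin (suc r)) m ≡ r * n + 1 →
  Counting.ColumnsFixDowns r true n m
columnsFixDowns-true (suc n) r m _ sum≡ bs (length≡ , sized) columns≡ =
  +-cancelˡ-≡ (r * suc n + 1) (numDown (concat bs)) n (begin
    r * suc n + 1 + numDown (concat bs)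
      ≡⟨ cong (_+ numDown (concat bs)) ups≡ ⟨
    ∑ (concat bs) (λ s → 𝟙 ⌊ s Bool.≟ true ⌋) + numDown (concat bs)
      ≡⟨ ups+downs≡length (concat bs) ⟩
    length (concat bs)
      ≡⟨ BlockSequences.length-concat (suc r) (suc n) (length≡ , sized) ⟩
    suc r * suc n
      ≡⟨ split r n ⟩
    r * suc n + 1 + n ∎)
  where
  open ≡-Reasoning
  ups≡ : ∑ (concat bs) (λ s → 𝟙 ⌊ s Bool.≟ true ⌋) ≡ r * suc n + 1
  ups≡ = trans (sym (PathBlocks.∑-column r true bs sized)) (trans (∑-ext (allFin (suc r)) columns≡) sum≡)
  split : ∀ r n → suc r * suc n ≡ r * suc n + 1 + n
  split = solve-∀

theorem16 : (n r : ℕ) → 1 ≤ n → 1 ≤ r →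
    ((m : Fin (suc r) → ℕ) → 2 ≤ m zero → (∀ i → 1 ≤ m (suc i)) →
      sum (map (λ i → m i ∸ 1) (allFin (suc r))) ≡ n ∸ 1 →
      (j : ℕ) → 1 ≤ j → j ≤ m zero ∸ 1 →
      (m zero ∸ 1) * count n r false (λ i → m i ∸ 1) j
        ≡ ((n ∸ 1) C (m zero ∸ 2)) * product (map (λ i → n C (m (suc i) ∸ 1)) (allFin r)))
    ×
    ((m : Fin (suc r) → ℕ) → 1 ≤ m zero →
      sum (map m (allFin (suc r))) ≡ r * n + 1 →
      (j : ℕ) → 1 ≤ j → j ≤ m zero →
      m zero * count n r true m j
        ≡ ((n ∸ 1) C (m zero ∸ 1)) * product (map (λ i → n C m (suc i)) (allFin r)))
theorem16 n r 1≤n _ =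
  (λ m 2≤m₀ _ sum≡ j 1≤j j≤ →
    trans (absorb-binomial n (m zero ∸ 1) _ _ 1≤n (∸-monoˡ-≤ 1 2≤m₀)
            (trans (Counting.n*count≡∏C r false n (λ i → m i ∸ 1) j 1≤n 1≤j j≤
                      (columnsFixDowns-false n r (λ i → m i ∸ 1) sum≡))
                   (∏-allFin-suc r (λ i → n C (m i ∸ 1)))))
          (cong (λ k → ((n ∸ 1) C k) * ∏ (allFin r) (λ i → n C (m (suc i) ∸ 1))) (∸-+-assoc (m zero) 1 1))) ,
  (λ m 1≤m₀ sum≡ j 1≤j j≤ →
    absorb-binomial n (m zero) _ _ 1≤n 1≤m₀
      (trans (Counting.n*count≡∏C r true n m j 1≤n 1≤j j≤ (columnsFixDowns-true n r m 1≤n sum≡))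
             (∏-allFin-suc r (λ i → n C m i))))
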